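{- Let $a,b,c\in\mathbb{N}$ with $a\le b\le c$, $3a\ge b+c$, $a+b+c\equiv 2$ or $3\pmod 4$, and $(a,b,c)\neq(1,1,1)$. Let $c'=c$ if $a+b+c$ is even and $c'=c-1$ otherwise, $S=(a+b+c')/2$, and $x=2a-S$, $y=2b-S$, $z=2c'-S$ (these are odd positive integers). Define three lists of length $x+y+z$, each the concatenation of a block of length $x-1$, a block of length $y-1$ and a block of length $z+2$ (a block of length $0$ is empty): First list: block 1 is $1,2,\dots,x-1$; block 2 is each of $x,x+1,\dots,x-1+(y-1)/2$ twice in increasing order; block 3 is $x+(y-1)/2$ once, followed by each of $x+(y-1)/2+1,\dots,a$ twice in increasing order. Second list: block 1 is each of $1,\dots,(x-1)/2$ twice in increasing order; block 2 is $(x-1)/2+1,(x-1)/2+2,\dots,(x-1)/2+y-1$ (each once); block 3 is $(x-1)/2+y,\ (x-1)/2+y+1$, followed by each of $(x-1)/2+y+2,\dots,b$ twice in increasing order, followed by $(x-1)/2+y$. Third list: block 1 is $1$, followed by each of $2,\dots,(x-1)/2$ twice in increasing order, followed by $1$; block 2 is $(x-1)/2+1$, followed by each of $(x-1)/2+2,\dots,(x-1)/2+(y-1)/2$ twice in increasing order, followed by $(x-1)/2+1$; block 3 is $(x-1)/2+(y-1)/2+1$ twice, followed by $(x-1)/2+(y-1)/2+2,\dots,c'$ (each once). For $k\in[x+y+z]$ let $q_k$ be the triple whose entries are the $k$-th entries of the three lists. Then $Q=\{q_1,\dots,q_{x+y+z}\}$ is a feasible strategy for $(a,b,c)$-Ma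stermind.
   Context: $[n]=\{1,\dots,n\}$. In $(a,b,c)$-Mastermind, secrets and questions are triples in $[a]\times[b]\times[c]$. $g(s,q)$ is the number of $k\in[3]$ with $s_k=q_k$. A strategy is a set $Q$ of questions; it is feasible if for all distinct secrets $s,s'$ there is $q\in Q$ with $g(s,q)\neq g(s',q)$. -}

module Defs where

open import Data.Nat using (ℕ; zero; suc; _+_; _*_; _∸_; _≤_; _≡ᵇ_)
open import Data.Nat.DivMod using (_/_; _%_)
open import Data.Bool using (Bool; true; false; if_then_else_)
open import Data.List using (List; []; _∷_; _++_; map; concatMap; upTo)
open import Data.List.Relation.Unary.All using (All)
open import Data.List.Relation.Unary.Any using (Any)
open import Data.Product using (_×_; _,_)
open import Relation.Binary.PropositionalEquality using (_≡_)
open import Relation.Nullary using (¬_)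

Triple : Set
Triple = ℕ × ℕ × ℕ

In[_] : ℕ → ℕ → Set
In[ n ] m = 1 ≤ m × m ≤ n

InBox : ℕ → ℕ → ℕ → Triple → Set
InBox a b c (s₁ , s₂ , s₃) = In[ a ] s₁ × In[ b ] s₂ × In[ c ] s₃

eqInd : ℕ → ℕ → ℕ
eqInd m n = if m ≡ᵇ n then 1 else 0

g : Triple → Triple → ℕ
g (s₁ , s₂ , s₃) (q₁ , q₂ , q₃) = eqInd s₁ q₁ + eqInd s₂ q₂ + eqInd s₃ q₃

IsStrategy : ℕ → ℕ → ℕ → List Triple → Set
IsStrategy a b c Q = All (InBox a b c) Q

Distinguishes : ℕ → ℕ → ℕ → List Triple → Set
Distinguishes a b c Q =
  ∀ s s' → InBox a b c s → InBox a b c s' → ¬ (s ≡ s') →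
  Any (λ q → ¬ (g s q ≡ g s' q)) Q

FeasibleStrategy : ℕ → ℕ → ℕ → List Triple → Set
FeasibleStrategy a b c Q = IsStrategy a b c Q × Distinguishes a b c Q

-- range lo hi = lo , lo+1 , … , hi   (empty if hi < lo)
range : ℕ → ℕ → List ℕ
range lo hi = map (lo +_) (upTo (suc hi ∸ lo))

twice : List ℕ → List ℕ
twice = concatMap (λ i → i ∷ i ∷ [])

block : ℕ → List ℕ → List ℕ
block len l = if len ≡ᵇ 0 then [] else l

-- k-th entry (0-indexed), default 0
at : List ℕ → ℕ → ℕ
at []       _       = 0
at (v ∷ vs) zero    = v
at (v ∷ vs) (suc k) = at vs k

c′ : ℕ → ℕ → ℕ → ℕ
c′ a b c = if (a + b + c) % 2 ≡ᵇ 0 then c else c ∸ 1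

S : ℕ → ℕ → ℕ → ℕ
S a b c = (a + b + c′ a b c) / 2

xp yp zp : ℕ → ℕ → ℕ → ℕ
xp a b c = 2 * a ∸ S a b c
yp a b c = 2 * b ∸ S a b c
zp a b c = 2 * c′ a b c ∸ S a b c

list₁ : ℕ → ℕ → ℕ → List ℕ
list₁ a b c =
  block (x ∸ 1) (range 1 (x ∸ 1))
  ++ block (y ∸ 1) (twice (range x (x ∸ 1 + (y ∸ 1) / 2)))
  ++ block (z + 2) ((x + (y ∸ 1) / 2) ∷ twice (range (x + (y ∸ 1) / 2 + 1) a))
  where
  x = xp a b c
  y = yp a b c
  z = zp a b c

list₂ : ℕ → ℕ → ℕ → List ℕ
list₂ a b c =
  block (x ∸ 1) (twice (range 1 h))
  ++ block (y ∸ 1) (range (h + 1) (h + (y ∸ 1)))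
  ++ block (z + 2) ((h + y) ∷ (h + y + 1) ∷ (twice (range (h + y + 2) b) ++ (h + y) ∷ []))
  where
  x = xp a b c
  y = yp a b c
  z = zp a b c
  h = (x ∸ 1) / 2

list₃ : ℕ → ℕ → ℕ → List ℕ
list₃ a b c =
  block (x ∸ 1) (1 ∷ (twice (range 2 h) ++ 1 ∷ []))
  ++ block (y ∸ 1) ((h + 1) ∷ (twice (range (h + 2) (h + k)) ++ (h + 1) ∷ []))
  ++ block (z + 2) ((h + k + 1) ∷ (h + k + 1) ∷ range (h + k + 2) (c′ a b c))
  where
  x = xp a b c
  y = yp a b c
  z = zp a b c
  h = (x ∸ 1) / 2
  k = (y ∸ 1) / 2

-- q_k for k ∈ [x+y+z] (here indexed 0,…,x+y+z-1): the k-th entries of the lists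
Qstrat : ℕ → ℕ → ℕ → List Triple
Qstrat a b c =
  map (λ k → at (list₁ a b c) k , at (list₂ a b c) k , at (list₃ a b c) k)
      (upTo (xp a b c + yp a b c + zp a b c))

-- In every column, questions with equal entries form classes of one or two questions. The
-- questions fall into three blocks: in the first two (the rings) one column separates all questions and the
-- other two pair them up around an even cycle; in the last one (the path) the three columns pair them up
-- around an odd cycle. Suppose different secrets s and t get the same answers, and ignore the columns where
-- they agree. Then wherever s is right in some column, t is right in exactly one other column, and vice versa;
-- following this along the classes of a block shows that column 3 takes part in every block where s or t is
-- right somewhere, that the classes of s and t in column 1 lie both inside or both outside the first ring and
-- are never together in the second ring or the path, where column 1 always takes part, and symmetrically for
-- column 2. Counting the classes of columns 1 and 2 then forces either no block or all three blocks to be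
-- involved, and the latter would need three classes of column 3. So s and t are right nowhere; as every value
-- in the box is asked, except possibly the largest one of column 3, this means s = t.

module Submission where

open import Data.Bool using (Bool; true; false; not; if_then_else_)
open import Data.Empty using (⊥; ⊥-elim)
open import Data.List using (List; []; _∷_; _++_; map; applyUpTo; upTo; length)
open import Data.List.Properties using (map-upTo; map-++; length-++)
open import Data.List.Membership.Propositional using (_∈_)
open import Data.List.Membership.Propositional.Properties using (∈-++⁺ˡ; ∈-++⁺ʳ; ∈-map⁺)
open import Data.List.Relation.Unary.All using (All; []; _∷_)
import Data.List.Relation.Unary.All as All
open import Data.List.Relation.Unary.All.Properties using (++⁺)
import Data.List.Relation.Unary.All.Properties as All
open import Data.List.Relation.Unary.Any using (here; there; any?)
import Data.List.Relation.Unary.Any as Any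
open import Data.Nat using (ℕ; zero; suc; _+_; _*_; _∸_; _≤_; _<_; z≤n; s≤s; _≡ᵇ_)
open import Data.Nat.DivMod using (_/_; _%_; m*n/n≡m; m≡m%n+[m/n]*n; [m+kn]%n≡m%n; m<n⇒m%n≡m)
open import Data.Nat.Properties
open import Data.Nat.Solver using (module +-*-Solver)
open +-*-Solver using (solve; _:+_; _:*_; _:=_; con)
open import Data.Product using (Σ; Σ-syntax; _×_; _,_; proj₁; proj₂)
open import Data.Product.Properties using (≡-dec)
open import Data.Sum using (_⊎_; inj₁; inj₂)
import Data.Sum
open import Data.Unit using (⊤; tt)
open import Relation.Binary.PropositionalEquality
open import Relation.Nullary using (¬_; Dec; yes; no; ¬?)
open import Relation.Nullary.Decidable using (decidable-stable)

open import Defs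

data Col : Set where
  c₁ c₂ c₃ : Col

_⟨_⟩ : Triple → Col → ℕ
(s , _ , _) ⟨ c₁ ⟩ = s
(_ , s , _) ⟨ c₂ ⟩ = s
(_ , _ , s) ⟨ c₃ ⟩ = s

_≟ᶜ_ : (x y : Col) → Dec (x ≡ y)
c₁ ≟ᶜ c₁ = yes refl
c₂ ≟ᶜ c₂ = yes refl
c₃ ≟ᶜ c₃ = yes refl
c₁ ≟ᶜ c₂ = no λ ()
c₁ ≟ᶜ c₃ = no λ ()
c₂ ≟ᶜ c₁ = no λ ()
c₂ ≟ᶜ c₃ = no λ ()
c₃ ≟ᶜ c₁ = no λ ()
c₃ ≟ᶜ c₂ = no λ ()

third : Col → Col → Col
third c₁ c₂ = c₃
third c₂ c₁ = c₃
third c₁ c₃ = c₂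
third c₃ c₁ = c₂
third c₂ c₃ = c₁
third c₃ c₂ = c₁
third c _ = c

only-third : ∀ {x y z} → x ≢ y → z ≢ x → z ≢ y → z ≡ third x y
only-third {c₁} {c₂} {c₃} _ _ _ = refl
only-third {c₂} {c₁} {c₃} _ _ _ = refl
only-third {c₁} {c₃} {c₂} _ _ _ = refl
only-third {c₃} {c₁} {c₂} _ _ _ = refl
only-third {c₂} {c₃} {c₁} _ _ _ = refl
only-third {c₃} {c₂} {c₁} _ _ _ = refl
only-third {c₁} {c₁} x≢y _ _ = ⊥-elim (x≢y refl)
only-third {c₂} {c₂} x≢y _ _ = ⊥-elim (x≢y refl)
only-third {c₃} {c₃} x≢y _ _ = ⊥-elim (x≢y refl)
only-third {c₁} {_} {c₁} _ z≢x _ = ⊥-elim (z≢x refl)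
only-third {c₂} {_} {c₂} _ z≢x _ = ⊥-elim (z≢x refl)
only-third {c₃} {_} {c₃} _ z≢x _ = ⊥-elim (z≢x refl)
only-third {_} {c₁} {c₁} _ _ z≢y = ⊥-elim (z≢y refl)
only-third {_} {c₂} {c₂} _ _ z≢y = ⊥-elim (z≢y refl)
only-third {_} {c₃} {c₃} _ _ z≢y = ⊥-elim (z≢y refl)

other : Col → Col
other c₁ = c₂
other c₂ = c₃
other c₃ = c₁

other-≢ : ∀ c → c ≢ other c
other-≢ c₁ ()
other-≢ c₂ ()
other-≢ c₃ ()

sum-by-third : ∀ {c d} (f : Col → ℕ) → c ≢ d → f c₁ + f c₂ + f c₃ ≡ f c + f d + f (third c d)
sum-by-third {c₁} {c₂} f _ = refl
sum-by-third {c₂} {c₁} f _ = solve 3 (λ a b c → a :+ b :+ c := b :+ a :+ c) refl (f c₁) (f c₂) (f c₃)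
sum-by-third {c₁} {c₃} f _ = solve 3 (λ a b c → a :+ b :+ c := a :+ c :+ b) refl (f c₁) (f c₂) (f c₃)
sum-by-third {c₃} {c₁} f _ = solve 3 (λ a b c → a :+ b :+ c := c :+ a :+ b) refl (f c₁) (f c₂) (f c₃)
sum-by-third {c₂} {c₃} f _ = solve 3 (λ a b c → a :+ b :+ c := b :+ c :+ a) refl (f c₁) (f c₂) (f c₃)
sum-by-third {c₃} {c₂} f _ = solve 3 (λ a b c → a :+ b :+ c := c :+ b :+ a) refl (f c₁) (f c₂) (f c₃)
sum-by-third {c₁} {c₁} f c≢d = ⊥-elim (c≢d refl)
sum-by-third {c₂} {c₂} f c≢d = ⊥-elim (c≢d refl)
sum-by-third {c₃} {c₃} f c≢d = ⊥-elim (c≢d refl)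

if-true : ∀ {A : Set} {b} {x y : A} → b ≡ true → (if b then x else y) ≡ x
if-true refl = refl

if-false : ∀ {A : Set} {b} {x y : A} → b ≡ false → (if b then x else y) ≡ y
if-false refl = refl

≡ᵇ-true : ∀ {m n} → m ≡ n → (m ≡ᵇ n) ≡ true
≡ᵇ-true {m} refl with m ≡ᵇ m | ≡⇒≡ᵇ m m refl
... | true | _ = refl

≡ᵇ-false : ∀ {m n} → m ≢ n → (m ≡ᵇ n) ≡ false
≡ᵇ-false {m} {n} m≢n with m ≡ᵇ n | ≡ᵇ⇒≡ m n
... | false | _ = refl
... | true | eq = ⊥-elim (m≢n (eq tt))

pairIndex : ℕ → Bool → ℕ
pairIndex zero false = 0
pairIndex zero true = 1
pairIndex (suc i) b = suc (suc (pairIndex i b))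

pairIndex-true : ∀ i → pairIndex i true ≡ suc (i + i)
pairIndex-true zero = refl
pairIndex-true (suc i) = cong (λ m → suc (suc m)) (trans (pairIndex-true i) (sym (+-suc i i)))

pairIndex-injective : ∀ {i j b b′} → pairIndex i b ≡ pairIndex j b′ → i ≡ j × b ≡ b′
pairIndex-injective {zero} {zero} {false} {false} _ = refl , refl
pairIndex-injective {zero} {zero} {true} {true} _ = refl , refl
pairIndex-injective {zero} {suc j} {false} ()
pairIndex-injective {zero} {suc j} {true} ()
pairIndex-injective {suc i} {zero} {_} {false} ()
pairIndex-injective {suc i} {zero} {_} {true} ()
pairIndex-injective {suc i} {suc j} e with pairIndex-injective {i} {j} (suc-injective (suc-injective e))
... | refl , refl = refl , refl

pairIndex-surjective : ∀ k → Σ[ i ∈ ℕ ] Σ[ b ∈ Bool ] pairIndex i b ≡ k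
pairIndex-surjective zero = 0 , false , refl
pairIndex-surjective (suc zero) = 0 , true , refl
pairIndex-surjective (suc (suc k)) with pairIndex-surjective k
... | i , b , e = suc i , b , cong (λ m → suc (suc m)) e

pairIndex-< : ∀ {i n} b → i < n → pairIndex i b < n + n
pairIndex-< {zero} {suc n} false _ = s≤s z≤n
pairIndex-< {zero} {suc n} true _ = s≤s (subst (1 ≤_) (sym (+-suc n n)) (s≤s z≤n))
pairIndex-< {suc i} {suc n} b (s≤s i<n) =
  subst (λ k → suc (pairIndex (suc i) b) ≤ suc k) (sym (+-suc n n)) (s≤s (s≤s (pairIndex-< b i<n)))

pairIndex-<⁻ : ∀ {i n} b → pairIndex i b < n + n → i < n
pairIndex-<⁻ {zero} {zero} false ()
pairIndex-<⁻ {zero} {zero} true ()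
pairIndex-<⁻ {zero} {suc n} _ _ = s≤s z≤n
pairIndex-<⁻ {suc i} {zero} _ ()
pairIndex-<⁻ {suc i} {suc n} b (s≤s lt) =
  s≤s (pairIndex-<⁻ b (≤-pred (subst (suc (suc (pairIndex i b)) ≤_) (+-suc n n) lt)))

pairIndex-≤ : ∀ {i n} b → i ≤ n → pairIndex i b ≤ pairIndex n true
pairIndex-≤ {zero} {zero} false _ = z≤n
pairIndex-≤ {zero} {zero} true _ = ≤-refl
pairIndex-≤ {zero} {suc n} b _ = ≤-trans (pairIndex-≤ {0} {n} b z≤n) (≤-trans (n≤1+n _) (n≤1+n _))
pairIndex-≤ {suc i} {suc n} b (s≤s i≤n) = s≤s (s≤s (pairIndex-≤ b i≤n))

pairIndex-≤⁻ : ∀ {i n} b → pairIndex i b ≤ pairIndex n true → i ≤ n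
pairIndex-≤⁻ {zero} _ _ = z≤n
pairIndex-≤⁻ {suc i} {zero} b (s≤s ())
pairIndex-≤⁻ {suc i} {suc n} b (s≤s (s≤s le)) = s≤s (pairIndex-≤⁻ b le)

cyclicSuc : ℕ → ℕ → ℕ
cyclicSuc n i = if suc i ≡ᵇ n then 0 else suc i

cyclicPred : ℕ → ℕ → ℕ
cyclicPred n zero = n ∸ 1
cyclicPred n (suc i) = i

data CyclicSuc (n i : ℕ) : ℕ → Set where
  wraps : suc i ≡ n → CyclicSuc n i 0
  steps : suc i ≢ n → CyclicSuc n i (suc i)

cyclicSuc-view : ∀ n i → CyclicSuc n i (cyclicSuc n i)
cyclicSuc-view n i with suc i ≟ n
... | yes e rewrite if-true {x = 0} {y = suc i} (≡ᵇ-true e) = wraps e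
... | no ne rewrite if-false {x = 0} {y = suc i} (≡ᵇ-false ne) = steps ne

cyclicSuc-< : ∀ {n i} → i < n → cyclicSuc n i < n
cyclicSuc-< {n} {i} i<n with cyclicSuc n i | cyclicSuc-view n i
... | _ | wraps _ = ≤-<-trans z≤n i<n
... | _ | steps ne = ≤∧≢⇒< i<n ne

cyclicPred-< : ∀ {n i} → i < n → cyclicPred n i < n
cyclicPred-< {suc n} {zero} _ = ≤-refl
cyclicPred-< {n} {suc i} i<n = <-trans (n<1+n i) i<n

cyclicSuc-cyclicPred : ∀ {n i} → i < n → cyclicSuc n (cyclicPred n i) ≡ i
cyclicSuc-cyclicPred {suc n} {zero} _ = if-true (≡ᵇ-true {suc n} refl)
cyclicSuc-cyclicPred {n} {suc i} i<n = if-false (≡ᵇ-false (<⇒≢ i<n))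

cyclicPred-cyclicSuc : ∀ {n i} → i < n → cyclicPred n (cyclicSuc n i) ≡ i
cyclicPred-cyclicSuc {n} {i} i<n with cyclicSuc n i | cyclicSuc-view n i
... | _ | wraps e = cong (_∸ 1) (sym e)
... | _ | steps _ = refl

cyclicSuc-moves : ∀ {n i} → 2 ≤ n → cyclicSuc n i ≢ i
cyclicSuc-moves {n} {i} 2≤n with cyclicSuc n i | cyclicSuc-view n i
... | _ | wraps e = λ { refl → <-irrefl e 2≤n }
... | _ | steps _ = λ e → 1+n≢n e

cyclicPred-moves : ∀ {n i} → 2 ≤ n → cyclicPred n i ≢ i
cyclicPred-moves {suc zero} {zero} (s≤s ()) _
cyclicPred-moves {suc (suc n)} {zero} _ ()
cyclicPred-moves {n} {suc i} _ e = 1+n≢n (sym e)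

cyclicSuc-suc-≢1 : ∀ n i → cyclicSuc n (suc i) ≢ 1
cyclicSuc-suc-≢1 n i with cyclicSuc n (suc i) | cyclicSuc-view n (suc i)
... | _ | wraps _ = λ ()
... | _ | steps _ = λ e → 1+n≢0 (suc-injective e)

data Side : Set where
  left right : Side

data Block : Set where
  ringᴮ : Side → Block
  pathᴮ : Block

_≟ᴮ_ : (β γ : Block) → Dec (β ≡ γ)
ringᴮ left ≟ᴮ ringᴮ left = yes refl
ringᴮ right ≟ᴮ ringᴮ right = yes refl
pathᴮ ≟ᴮ pathᴮ = yes refl
ringᴮ left ≟ᴮ ringᴮ right = no λ ()
ringᴮ right ≟ᴮ ringᴮ left = no λ ()
ringᴮ _ ≟ᴮ pathᴮ = no λ ()
pathᴮ ≟ᴮ ringᴮ _ = no λ ()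

-- The questions of the three blocks of the statement, in list order: ring left i b and ring right i b
-- are the entries 2i+b of the first two blocks, apex is the first entry of the last block and
-- path i b its entry 2i+b+1.
data Pos : Set where
  ring : Side → ℕ → Bool → Pos
  path : ℕ → Bool → Pos
  apex : Pos

blockOf : Pos → Block
blockOf (ring sd _ _) = ringᴮ sd
blockOf (path _ _) = pathᴮ
blockOf apex = pathᴮ

Bounded : ℕ → ℕ → ℕ → Block × ℕ → Set
Bounded n₁ n₂ m (ringᴮ left , k) = k < n₁
Bounded n₁ n₂ m (ringᴮ right , k) = k < n₂
Bounded n₁ n₂ m (pathᴮ , k) = k ≤ m

layout : ℕ → ℕ → Block × ℕ → ℕ
layout n₁ n₂ (ringᴮ left , k) = k
layout n₁ n₂ (ringᴮ right , k) = n₁ + k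
layout n₁ n₂ (pathᴮ , k) = n₁ + n₂ + k

private
  <⇒≢+ : ∀ {k n m} → k < n → k ≢ n + m
  <⇒≢+ {n = n} {m} k<n refl = <-irrefl refl (<-≤-trans k<n (m≤m+n n m))

layout-injective : ∀ {n₁ n₂ m} p q → Bounded n₁ n₂ m p → Bounded n₁ n₂ m q →
                   layout n₁ n₂ p ≡ layout n₁ n₂ q → p ≡ q
layout-injective (ringᴮ left , k) (ringᴮ left , l) _ _ refl = refl
layout-injective (ringᴮ left , k) (ringᴮ right , l) k< _ e = ⊥-elim (<⇒≢+ k< e)
layout-injective {n₁} {n₂} (ringᴮ left , k) (pathᴮ , l) k< _ e =
  ⊥-elim (<⇒≢+ k< (trans e (+-assoc n₁ n₂ l)))
layout-injective (ringᴮ right , k) (ringᴮ left , l) _ l< e = ⊥-elim (<⇒≢+ l< (sym e))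
layout-injective {n₁} (ringᴮ right , k) (ringᴮ right , l) _ _ e = cong (ringᴮ right ,_) (+-cancelˡ-≡ n₁ k l e)
layout-injective {n₁} {n₂} (ringᴮ right , k) (pathᴮ , l) k< _ e =
  ⊥-elim (<⇒≢+ k< (+-cancelˡ-≡ n₁ k (n₂ + l) (trans e (+-assoc n₁ n₂ l))))
layout-injective {n₁} {n₂} (pathᴮ , k) (ringᴮ left , l) _ l< e =
  ⊥-elim (<⇒≢+ l< (trans (sym e) (+-assoc n₁ n₂ k)))
layout-injective {n₁} {n₂} (pathᴮ , k) (ringᴮ right , l) _ l< e =
  ⊥-elim (<⇒≢+ l< (+-cancelˡ-≡ n₁ l (n₂ + k) (trans (sym e) (+-assoc n₁ n₂ k))))
layout-injective {n₁} {n₂} (pathᴮ , k) (pathᴮ , l) _ _ e = cong (pathᴮ ,_) (+-cancelˡ-≡ (n₁ + n₂) k l e)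

layout-bounded : ∀ {n₁ n₂ m} p → Bounded n₁ n₂ m p → layout n₁ n₂ p ≤ n₁ + n₂ + m
layout-bounded {n₁} {n₂} {m} (ringᴮ left , k) k< = ≤-trans (<⇒≤ k<) (≤-trans (m≤m+n n₁ n₂) (m≤m+n (n₁ + n₂) m))
layout-bounded {n₁} {n₂} {m} (ringᴮ right , k) k< = ≤-trans (+-monoʳ-≤ n₁ (<⇒≤ k<)) (m≤m+n (n₁ + n₂) m)
layout-bounded {n₁} {n₂} (pathᴮ , k) k≤ = +-monoʳ-≤ (n₁ + n₂) k≤

layout-onto : ∀ {n₁ n₂ m} u → u ≤ n₁ + n₂ + m → Σ[ p ∈ Block × ℕ ] Bounded n₁ n₂ m p × layout n₁ n₂ p ≡ u
layout-onto {n₁} {n₂} {m} u u≤ with u <? n₁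
... | yes u< = (ringᴮ left , u) , u< , refl
... | no u≮ with u ∸ n₁ <? n₂
...   | yes u′< = (ringᴮ right , u ∸ n₁) , u′< , m+[n∸m]≡n (≮⇒≥ u≮)
...   | no u′≮ = (pathᴮ , u ∸ n₁ ∸ n₂) , +-cancelˡ-≤ (n₁ + n₂) _ _ (subst (_≤ n₁ + n₂ + m) split u≤) , sym split
  where
  split : u ≡ n₁ + n₂ + (u ∸ n₁ ∸ n₂)
  split = begin
    u                               ≡⟨ m+[n∸m]≡n (≮⇒≥ u≮) ⟨
    n₁ + (u ∸ n₁)                   ≡⟨ cong (n₁ +_) (m+[n∸m]≡n (≮⇒≥ u′≮)) ⟨
    n₁ + (n₂ + (u ∸ n₁ ∸ n₂))       ≡⟨ +-assoc n₁ n₂ _ ⟨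
    n₁ + n₂ + (u ∸ n₁ ∸ n₂)         ∎
    where open ≡-Reasoning

data Link : Set where
  along across : Link

turn : Link → Link
turn along = across
turn across = along

_≟ˡ_ : (l l′ : Link) → Dec (l ≡ l′)
along ≟ˡ along = yes refl
across ≟ˡ across = yes refl
along ≟ˡ across = no λ ()
across ≟ˡ along = no λ ()

along≢across : along ≢ across
along≢across ()

turn-≢ : ∀ {l l′} → l′ ≢ l → turn l′ ≡ l
turn-≢ {along} {along} ne = ⊥-elim (ne refl)
turn-≢ {across} {across} ne = ⊥-elim (ne refl)
turn-≢ {along} {across} _ = refl
turn-≢ {across} {along} _ = refl

link-≢ : ∀ {l l₁ l₂} → l₁ ≢ l → l₁ ≢ l₂ → l₂ ≡ l
link-≢ n₁ n₂ = trans (sym (turn-≢ n₂)) (turn-≢ n₁)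

lone paired : Side → Col
lone left = c₁
lone right = c₂
paired left = c₂
paired right = c₁

linkCol : Side → Link → Col
linkCol sd along = paired sd
linkCol sd across = c₃

data RingCol (sd : Side) : Col → Set where
  is-lone : RingCol sd (lone sd)
  is-link : ∀ l → RingCol sd (linkCol sd l)

ringCol : ∀ sd c → RingCol sd c
ringCol left c₁ = is-lone
ringCol left c₂ = is-link along
ringCol left c₃ = is-link across
ringCol right c₁ = is-link along
ringCol right c₂ = is-lone
ringCol right c₃ = is-link across

lone≢link : ∀ sd l → lone sd ≢ linkCol sd l
lone≢link left along ()
lone≢link left across ()
lone≢link right along ()
lone≢link right across ()

linkCol-injective : ∀ sd {l l′} → linkCol sd l ≡ linkCol sd l′ → l ≡ l′
linkCol-injective left {along} {along} _ = refl
linkCol-injective left {across} {across} _ = refl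
linkCol-injective right {along} {along} _ = refl
linkCol-injective right {across} {across} _ = refl

third-lone-link : ∀ sd l → third (lone sd) (linkCol sd l) ≡ linkCol sd (turn l)
third-lone-link left along = refl
third-lone-link left across = refl
third-lone-link right along = refl
third-lone-link right across = refl

third-links : ∀ sd l → third (linkCol sd l) (linkCol sd (turn l)) ≡ lone sd
third-links left along = refl
third-links left across = refl
third-links right along = refl
third-links right across = refl

pairs : {A : Set} → (ℕ → Bool → A) → ℕ → List A
pairs f zero = []
pairs f (suc n) = f 0 false ∷ f 0 true ∷ pairs (λ i → f (suc i)) n

length-pairs : ∀ {A : Set} (f : ℕ → Bool → A) n → length (pairs f n) ≡ n + n
length-pairs f zero = refl
length-pairs f (suc n) = cong suc (trans (cong suc (length-pairs (λ i → f (suc i)) n)) (sym (+-suc n n)))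

∈-pairs : ∀ {A : Set} (f : ℕ → Bool → A) {i n} b → i < n → f i b ∈ pairs f n
∈-pairs f {zero} {suc n} false _ = here refl
∈-pairs f {zero} {suc n} true _ = there (here refl)
∈-pairs f {suc i} {suc n} b (s≤s i<n) = there (there (∈-pairs (λ j → f (suc j)) b i<n))

All-pairs : ∀ {A : Set} {P : A → Set} (f : ℕ → Bool → A) n → (∀ {i} b → i < n → P (f i b)) → All P (pairs f n)
All-pairs f zero _ = []
All-pairs f (suc n) p = p false (s≤s z≤n) ∷ p true (s≤s z≤n) ∷ All-pairs (λ i → f (suc i)) n (λ b i<n → p b (s≤s i<n))

module Questions (X Y Z : ℕ) where

  variable
    s t : Triple
    c d x y : Col
    P Q : Pos

  ringSize : Side → ℕ
  ringSize left = X
  ringSize right = Y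

  Valid : Pos → Set
  Valid (ring sd i _) = i < ringSize sd
  Valid (path i _) = i ≤ Z
  Valid apex = ⊤

  -- offset c P numbers the column-c class of P within its block.
  offset : Col → Pos → ℕ
  offset c₁ (ring left i b) = pairIndex i b
  offset c₂ (ring left i _) = i
  offset c₁ (ring right i _) = i
  offset c₂ (ring right i b) = pairIndex i b
  offset c₃ (ring sd i false) = i
  offset c₃ (ring sd i true) = cyclicSuc (ringSize sd) i
  offset c₁ apex = 0
  offset c₁ (path i _) = suc i
  offset c₂ apex = 0
  offset c₂ (path i false) = suc i
  offset c₂ (path i true) = cyclicSuc (suc (suc Z)) (suc i)
  offset c₃ apex = 0
  offset c₃ (path i b) = pairIndex i b

  coord : Col → Pos → Block × ℕ
  coord c P = blockOf P , offset c P

  width : Col → Side → ℕ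
  width c₁ left = X + X
  width c₂ left = X
  width c₃ left = X
  width c₁ right = Y
  width c₂ right = Y + Y
  width c₃ right = Y

  top : Col → ℕ
  top c₁ = suc Z
  top c₂ = suc Z
  top c₃ = pairIndex Z true

  size : Col → ℕ
  size c = suc (width c left + width c right + top c)

  F : Col → Pos → ℕ
  F c P = suc (layout (width c left) (width c right) (coord c P))

  question : Pos → Triple
  question P = F c₁ P , F c₂ P , F c₃ P

  coord-bounded : ∀ c P → Valid P → Bounded (width c left) (width c right) (top c) (coord c P)
  coord-bounded c₁ (ring left i b) v = pairIndex-< b v
  coord-bounded c₂ (ring left i b) v = v
  coord-bounded c₁ (ring right i b) v = v
  coord-bounded c₂ (ring right i b) v = pairIndex-< b v
  coord-bounded c₃ (ring left i false) v = v
  coord-bounded c₃ (ring left i true) v = cyclicSuc-< v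
  coord-bounded c₃ (ring right i false) v = v
  coord-bounded c₃ (ring right i true) v = cyclicSuc-< v
  coord-bounded c₁ (path _ _) v = s≤s v
  coord-bounded c₂ (path _ false) v = s≤s v
  coord-bounded c₂ (path _ true) v = ≤-pred (cyclicSuc-< (s≤s (s≤s v)))
  coord-bounded c₃ (path _ b) v = pairIndex-≤ b v
  coord-bounded c₁ apex _ = z≤n
  coord-bounded c₂ apex _ = z≤n
  coord-bounded c₃ apex _ = z≤n

  F-class : ∀ c → Valid P → Valid Q → F c P ≡ F c Q → coord c P ≡ coord c Q
  F-class {P} {Q} c vP vQ e =
    layout-injective (coord c P) (coord c Q) (coord-bounded c P vP) (coord-bounded c Q vQ) (suc-injective e)

  F-bounded : ∀ c → Valid P → F c P ≤ size c
  F-bounded {P} c v = s≤s (layout-bounded (coord c P) (coord-bounded c P v))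

  representative : ∀ c p → Bounded (width c left) (width c right) (top c) p → Σ[ Q ∈ Pos ] Valid Q × coord c Q ≡ p
  representative c₁ (ringᴮ left , k) k< with pairIndex-surjective k
  ... | i , b , refl = ring left i b , pairIndex-<⁻ b k< , refl
  representative c₁ (ringᴮ right , k) k< = ring right k false , k< , refl
  representative c₁ (pathᴮ , zero) _ = apex , tt , refl
  representative c₁ (pathᴮ , suc i) i< = path i false , ≤-pred i< , refl
  representative c₂ (ringᴮ left , k) k< = ring left k false , k< , refl
  representative c₂ (ringᴮ right , k) k< with pairIndex-surjective k
  ... | i , b , refl = ring right i b , pairIndex-<⁻ b k< , refl
  representative c₂ (pathᴮ , zero) _ = apex , tt , refl
  representative c₂ (pathᴮ , suc i) i< = path i false , ≤-pred i< , refl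
  representative c₃ (ringᴮ left , k) k< = ring left k false , k< , refl
  representative c₃ (ringᴮ right , k) k< = ring right k false , k< , refl
  representative c₃ (pathᴮ , k) k≤ with pairIndex-surjective k
  ... | i , b , refl = path i b , pairIndex-≤⁻ b k≤ , refl

  F-onto : ∀ c v → 1 ≤ v → v ≤ size c → Σ[ Q ∈ Pos ] Valid Q × v ≡ F c Q
  F-onto c (suc u) _ v≤ with layout-onto {width c left} {width c right} {top c} u (≤-pred v≤)
  ... | p , bounded , refl with representative c p bounded
  ...   | Q , vQ , refl = Q , vQ , refl

  allPos : List Pos
  allPos = pairs (ring left) X ++ pairs (ring right) Y ++ apex ∷ pairs path (suc Z)

  valid-∈ : Valid P → P ∈ allPos
  valid-∈ {ring left i b} v = ∈-++⁺ˡ (∈-pairs (ring left) b v)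
  valid-∈ {ring right i b} v = ∈-++⁺ʳ (pairs (ring left) X) (∈-++⁺ˡ (∈-pairs (ring right) b v))
  valid-∈ {apex} _ = ∈-++⁺ʳ (pairs (ring left) X) (∈-++⁺ʳ (pairs (ring right) Y) (here refl))
  valid-∈ {path i b} v = ∈-++⁺ʳ (pairs (ring left) X) (∈-++⁺ʳ (pairs (ring right) Y) (there (∈-pairs path b (s≤s v))))

  allPos-valid : All Valid allPos
  allPos-valid = ++⁺ (All-pairs (ring left) X (λ _ v → v))
                     (++⁺ (All-pairs (ring right) Y (λ _ v → v)) (tt ∷ All-pairs path (suc Z) (λ _ v → ≤-pred v)))

  length-allPos : length allPos ≡ suc (X + X) + suc (Y + Y) + suc (Z + Z)
  length-allPos = begin
    length allPos
      ≡⟨ length-++ (pairs (ring left) X) ⟩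
    length (pairs (ring left) X) + length (pairs (ring right) Y ++ apex ∷ pairs path (suc Z))
      ≡⟨ cong (length (pairs (ring left) X) +_) (length-++ (pairs (ring right) Y)) ⟩
    length (pairs (ring left) X) + (length (pairs (ring right) Y) + suc (length (pairs path (suc Z))))
      ≡⟨ cong₂ (λ l m → l + (m + suc (length (pairs path (suc Z))))) (length-pairs (ring left) X) (length-pairs (ring right) Y) ⟩
    X + X + (Y + Y + suc (length (pairs path (suc Z))))
      ≡⟨ cong (λ l → X + X + (Y + Y + suc l)) (length-pairs path (suc Z)) ⟩
    X + X + (Y + Y + suc (suc Z + suc Z))
      ≡⟨ solve 3 (λ X Y Z → X :+ X :+ (Y :+ Y :+ (con 1 :+ ((con 1 :+ Z) :+ (con 1 :+ Z))))
                         := (con 1 :+ (X :+ X)) :+ (con 1 :+ (Y :+ Y)) :+ (con 1 :+ (Z :+ Z))) refl X Y Z ⟩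
    suc (X + X) + suc (Y + Y) + suc (Z + Z) ∎
    where open ≡-Reasoning

  tabulated : ∀ ps → applyUpTo (λ k → at (map (F c₁) ps) k , at (map (F c₂) ps) k , at (map (F c₃) ps) k) (length ps)
                     ≡ map question ps
  tabulated [] = refl
  tabulated (P ∷ ps) = cong (question P ∷_) (tabulated ps)

  -- Answers of two secrets

  record SameAnswers (s t : Triple) : Set where
    field
      same-answer : ∀ P → Valid P → g s (question P) ≡ g t (question P)
  open SameAnswers public

  SameAnswers-sym : SameAnswers s t → SameAnswers t s
  SameAnswers-sym ans = record { same-answer = λ P v → sym (same-answer ans P v) }

  record Hit (s t : Triple) (c : Col) (P : Pos) : Set where
    constructor hit
    field
      valid : Valid P
      differs : s ⟨ c ⟩ ≢ t ⟨ c ⟩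
      agrees : s ⟨ c ⟩ ≡ F c P
  open Hit public

  hit? : ∀ s t c → Valid P → Dec (Hit s t c P)
  hit? {P} s t c v with s ⟨ c ⟩ ≟ t ⟨ c ⟩ | s ⟨ c ⟩ ≟ F c P
  ... | yes e | _ = no (λ h → differs h e)
  ... | no _ | no ne = no (λ h → ne (agrees h))
  ... | no ne | yes e = yes (hit v ne e)

  spread : Hit s t c P → ∀ Q → Valid Q → coord c Q ≡ coord c P → Hit s t c Q
  spread {c = c} h Q vQ e =
    hit vQ (differs h) (trans (agrees h) (cong (λ p → suc (layout (width c left) (width c right) p)) (sym e)))

  same-class : Hit s t c P → Hit s t c Q → coord c P ≡ coord c Q
  same-class {c = c} h k = F-class c (valid h) (valid k) (trans (sym (agrees h)) (agrees k))

  not-both : Hit s t c P → Hit t s c P → ⊥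
  not-both h k = differs h (trans (agrees h) (sym (agrees k)))

  score : Triple → Pos → Col → ℕ
  score s P c = eqInd (s ⟨ c ⟩) (F c P)

  score-hit : Hit s t c P → score s P c ≡ 1
  score-hit h = if-true (≡ᵇ-true (agrees h))

  score-other : Hit s t c P → score t P c ≡ 0
  score-other h = if-false (≡ᵇ-false (λ e → differs h (trans (agrees h) (sym e))))

  score-≤1 : ∀ s P c → score s P c ≤ 1
  score-≤1 s P c with s ⟨ c ⟩ ≡ᵇ F c P
  ... | true = ≤-refl
  ... | false = z≤n

  score-≤ : ∀ c → Valid P → ¬ Hit t s c P → score t P c ≤ score s P c
  score-≤ {P} {t} {s} c v miss with s ⟨ c ⟩ ≟ t ⟨ c ⟩ | t ⟨ c ⟩ ≟ F c P
  ... | yes e | _ rewrite e = ≤-refl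
  ... | no ne | yes e = ⊥-elim (miss (hit v (λ e′ → ne (sym e′)) e))
  ... | no _ | no ne rewrite if-false {x = 1} {y = 0} (≡ᵇ-false ne) = z≤n

  answer-split : ∀ s P → c ≢ d → g s (question P) ≡ score s P c + score s P d + score s P (third c d)
  answer-split s P = sum-by-third (score s P)

  hit-unique : SameAnswers s t → Hit s t c P → Hit s t d P → c ≡ d
  hit-unique {s} {t} {c} {P} {d} ans h k with c ≟ᶜ d
  ... | yes e = e
  ... | no c≢d = ⊥-elim (<-irrefl (sym (same-answer ans P (valid h))) fewer)
    where
    open ≤-Reasoning
    fewer : g t (question P) < g s (question P)
    fewer = begin-strict
      g t (question P)                                    ≡⟨ answer-split t P c≢d ⟩
      score t P c + score t P d + score t P (third c d)   ≡⟨ cong₂ (λ m n → m + n + score t P (third c d)) (score-other h) (score-other k) ⟩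
      score t P (third c d)                               ≤⟨ score-≤1 t P (third c d) ⟩
      1                                                   <⟨ s≤s (s≤s z≤n) ⟩
      1 + 1 + score s P (third c d)                       ≡⟨ cong₂ (λ m n → m + n + score s P (third c d)) (score-hit h) (score-hit k) ⟨
      score s P c + score s P d + score s P (third c d)   ≡⟨ answer-split s P c≢d ⟨
      g s (question P)                                    ∎

  answered : SameAnswers s t → Hit s t c P → Σ[ d ∈ Col ] Hit t s d P
  answered {s} {t} {c} {P} ans h with hit? t s c₁ (valid h) | hit? t s c₂ (valid h) | hit? t s c₃ (valid h)
  ... | yes k | _ | _ = c₁ , k
  ... | no _ | yes k | _ = c₂ , k
  ... | no _ | no _ | yes k = c₃ , k
  ... | no m₁ | no m₂ | no m₃ = ⊥-elim (<-irrefl (sym (same-answer ans P (valid h))) fewer)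
    where
    miss : ∀ d → ¬ Hit t s d P
    miss c₁ = m₁
    miss c₂ = m₂
    miss c₃ = m₃
    e = third c (other c)
    hit-scores : score t P c < score s P c
    hit-scores rewrite score-other h | score-hit h = s≤s z≤n
    open ≤-Reasoning
    fewer : g t (question P) < g s (question P)
    fewer = begin-strict
      g t (question P)                                ≡⟨ answer-split t P (other-≢ c) ⟩
      score t P c + score t P (other c) + score t P e <⟨ +-mono-<-≤ (+-mono-<-≤ hit-scores (score-≤ (other c) (valid h) (miss _)))
                                                                    (score-≤ e (valid h) (miss _)) ⟩
      score s P c + score s P (other c) + score s P e ≡⟨ answer-split s P (other-≢ c) ⟨
      g s (question P)                                ∎

  collide : SameAnswers s t → Hit s t c P → Hit s t d P → c ≢ d → ⊥
  collide ans h h′ c≢d = c≢d (hit-unique ans h h′)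

  step : SameAnswers s t → Hit s t x P → Hit t s y P → ∀ Q → Valid Q →
         coord y Q ≡ coord y P → coord x Q ≢ coord x P → Hit s t (third x y) Q
  step {s} {t} {x} {P} {y} ans h k Q vQ same new with answered (SameAnswers-sym ans) (spread k Q vQ same)
  ... | z , h′ = subst (λ z → Hit s t z Q) (only-third x≢y z≢x z≢y) h′
    where
    x≢y : x ≢ y
    x≢y refl = not-both h k
    z≢x : z ≢ x
    z≢x refl = new (same-class h′ h)
    z≢y : z ≢ y
    z≢y refl = not-both h′ (spread k Q vQ same)

  Covers : Triple → Triple → Block → Col → Set
  Covers s t β c = Σ[ P ∈ Pos ] blockOf P ≡ β × Hit s t c P

  Involved : Triple → Triple → Block → Col → Set
  Involved s t β c = Covers s t β c ⊎ Covers t s β c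

  mine : ∀ {β} → blockOf P ≡ β → Hit s t c P → Involved s t β c
  mine inP h = inj₁ (_ , inP , h)

  theirs : ∀ {β} → blockOf P ≡ β → Hit t s c P → Involved s t β c
  theirs inP k = inj₂ (_ , inP , k)

  -- The two rings

  data Cell (sd : Side) : Pos → Set where
    cell : ∀ {i} b → i < ringSize sd → Cell sd (ring sd i b)

  cell-valid : ∀ {sd} → Cell sd P → Valid P
  cell-valid (cell _ i<n) = i<n

  to-cell : ∀ {sd} → Valid P → blockOf P ≡ ringᴮ sd → Cell sd P
  to-cell {ring sd i b} v refl = cell b v

  -- In a ring the lone column has singleton classes, while the classes of a link column l are the pairs
  -- {P , mate l P}: along joins the two questions of a cell, across joins a cell to the next one, cyclically.
  mate : Link → Pos → Pos
  mate along (ring sd i b) = ring sd i (not b)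
  mate across (ring sd i true) = ring sd (cyclicSuc (ringSize sd) i) false
  mate across (ring sd i false) = ring sd (cyclicPred (ringSize sd) i) true
  mate _ P = P

  mate-cell : ∀ {sd} l → Cell sd P → Cell sd (mate l P)
  mate-cell along (cell b i<n) = cell (not b) i<n
  mate-cell across (cell true i<n) = cell false (cyclicSuc-< i<n)
  mate-cell across (cell false i<n) = cell true (cyclicPred-< i<n)

  mate-mate : ∀ {sd} l → Cell sd P → mate l (mate l P) ≡ P
  mate-mate along (cell false _) = refl
  mate-mate along (cell true _) = refl
  mate-mate {sd = sd} across (cell true i<n) = cong (λ j → ring sd j true) (cyclicPred-cyclicSuc i<n)
  mate-mate {sd = sd} across (cell false i<n) = cong (λ j → ring sd j false) (cyclicSuc-cyclicPred i<n)

  lone-offset : ∀ sd {i b} → offset (lone sd) (ring sd i b) ≡ pairIndex i b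
  lone-offset left = refl
  lone-offset right = refl

  paired-offset : ∀ sd {i b} → offset (paired sd) (ring sd i b) ≡ i
  paired-offset left = refl
  paired-offset right = refl

  mate-coord : ∀ {sd} l → Cell sd P → coord (linkCol sd l) (mate l P) ≡ coord (linkCol sd l) P
  mate-coord {sd = sd} along (cell b _) = cong (ringᴮ sd ,_) (trans (paired-offset sd) (sym (paired-offset sd)))
  mate-coord across (cell true _) = refl
  mate-coord {sd = sd} across (cell false i<n) = cong (ringᴮ sd ,_) (cyclicSuc-cyclicPred i<n)

  lone-index : ∀ {sd i j b b′} → coord (lone sd) (ring sd j b′) ≡ coord (lone sd) (ring sd i b) → pairIndex j b′ ≡ pairIndex i b
  lone-index {sd} e = trans (sym (lone-offset sd)) (trans (cong proj₂ e) (lone-offset sd))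

  paired-index : ∀ {sd i j b b′} → coord (paired sd) (ring sd j b′) ≡ coord (paired sd) (ring sd i b) → j ≡ i
  paired-index {sd} e = trans (sym (paired-offset sd)) (trans (cong proj₂ e) (paired-offset sd))

  mate-lone : ∀ {sd} l → Cell sd P → coord (lone sd) (mate l P) ≢ coord (lone sd) P
  mate-lone along (cell false _) e with pairIndex-injective (lone-index e)
  ... | _ , ()
  mate-lone along (cell true _) e with pairIndex-injective (lone-index e)
  ... | _ , ()
  mate-lone across (cell true _) e with pairIndex-injective (lone-index e)
  ... | _ , ()
  mate-lone across (cell false _) e with pairIndex-injective (lone-index e)
  ... | _ , ()

  lone-class : ∀ {sd} → Cell sd P → coord (lone sd) Q ≡ coord (lone sd) P → Q ≡ P
  lone-class {Q = ring sd′ j b′} (cell {i} b _) e with cong proj₁ e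
  lone-class {Q = ring sd j b′} (cell {i} b _) e | refl with pairIndex-injective (lone-index e)
  ... | refl , refl = refl
  lone-class {Q = path _ _} (cell _ _) ()
  lone-class {Q = apex} (cell _ _) ()

  link-class : ∀ {sd} l → Cell sd P → Cell sd Q → coord (linkCol sd l) Q ≡ coord (linkCol sd l) P → Q ≡ P ⊎ Q ≡ mate l P
  link-class along (cell b _) (cell b′ _) e with paired-index e
  link-class along (cell false _) (cell false _) e | refl = inj₁ refl
  link-class along (cell true _) (cell true _) e | refl = inj₁ refl
  link-class along (cell false _) (cell true _) e | refl = inj₂ refl
  link-class along (cell true _) (cell false _) e | refl = inj₂ refl
  link-class across (cell false _) (cell false _) refl = inj₁ refl
  link-class across (cell true _) (cell false _) refl = inj₂ refl
  link-class {sd = sd} across (cell {i} false i<n) (cell {j} true j<n) e =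
    inj₂ (cong (λ k → ring sd k true) (trans (sym (cyclicPred-cyclicSuc j<n)) (cong (cyclicPred (ringSize sd)) (cong proj₂ e))))
  link-class {sd = sd} across (cell {i} true i<n) (cell {j} true j<n) e =
    inj₁ (cong (λ k → ring sd k true)
      (trans (sym (cyclicPred-cyclicSuc j<n)) (trans (cong (cyclicPred (ringSize sd)) (cong proj₂ e)) (cyclicPred-cyclicSuc i<n))))

  ring-nonempty : ∀ {sd} → Cell sd P → 1 ≤ ringSize sd
  ring-nonempty (cell _ i<n) = ≤-<-trans z≤n i<n

  cell-block : ∀ {sd} → Cell sd P → blockOf P ≡ ringᴮ sd
  cell-block (cell _ _) = refl

  lone-walk : ∀ {sd} → SameAnswers s t → ∀ l → Cell sd P → Hit s t (lone sd) P → Hit t s (linkCol sd l) P →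
              Hit s t (linkCol sd (turn l)) (mate l P) × Hit t s (lone sd) (mate (turn l) (mate l P))
  lone-walk {s} {t} {P} {sd} ans l cP h k = h₁ , h₂
    where
    cW = mate-cell l cP
    cU = mate-cell (turn l) cW
    h₁ : Hit s t (linkCol sd (turn l)) (mate l P)
    h₁ = subst (λ c → Hit s t c (mate l P)) (third-lone-link sd l)
           (step ans h k (mate l P) (cell-valid cW) (mate-coord l cP) (mate-lone l cP))
    k₁ : Hit t s (linkCol sd l) (mate l P)
    k₁ = spread k (mate l P) (cell-valid cW) (mate-coord l cP)
    -- The second step fails only in a ring of a single cell, where it leads back to P.
    h₂ : Hit t s (lone sd) (mate (turn l) (mate l P))
    h₂ with ≡-dec _≟ᴮ_ _≟_ (coord (linkCol sd l) (mate (turn l) (mate l P))) (coord (linkCol sd l) (mate l P))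
    ... | no new = subst (λ c → Hit t s c (mate (turn l) (mate l P))) (third-links sd l)
                     (step (SameAnswers-sym ans) k₁ h₁ _ (cell-valid cU) (mate-coord (turn l) cW) new)
    ... | yes same with link-class l cW cU same
    ...   | inj₁ U≡W = ⊥-elim (mate-lone (turn l) cW (cong (coord (lone sd)) U≡W))
    ...   | inj₂ U≡P = ⊥-elim (lone≢link sd (turn l) (hit-unique ans h h₁′))
      where
      h₁′ : Hit s t (linkCol sd (turn l)) P
      h₁′ = spread h₁ P (cell-valid cP)
              (trans (cong (coord (linkCol sd (turn l))) (sym (trans U≡P (mate-mate l cP)))) (mate-coord (turn l) cW))

  crossing-leaves-pair : ∀ {sd} → 2 ≤ ringSize sd → Cell sd P → coord (paired sd) (mate across P) ≢ coord (paired sd) P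
  crossing-leaves-pair 2≤n (cell true _) e =
    cyclicSuc-moves 2≤n (paired-index e)
  crossing-leaves-pair 2≤n (cell false _) e =
    cyclicPred-moves 2≤n (paired-index e)

  one-pair : ∀ {sd} → ringSize sd ≡ 1 → Cell sd P → Cell sd Q → coord (paired sd) P ≡ coord (paired sd) Q
  one-pair {sd = sd} n≡1 (cell {i} _ i<n) (cell {j} _ j<n) =
    cong (ringᴮ sd ,_) (trans (paired-offset sd) (trans (trans (below-one i<n) (sym (below-one j<n))) (sym (paired-offset sd))))
    where
    below-one : ∀ {k} → k < ringSize sd → k ≡ 0
    below-one k<n = n<1⇒n≡0 (subst (_ <_) n≡1 k<n)

  lone-balanced : ∀ {sd} → SameAnswers s t → Covers s t (ringᴮ sd) (lone sd) → Covers t s (ringᴮ sd) (lone sd)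
  lone-balanced {sd = sd} ans (P , inP , h) with answered ans h
  ... | d , k with ringCol sd d
  ...   | is-lone = ⊥-elim (not-both h k)
  ...   | is-link l = _ , cell-block (mate-cell (turn l) (mate-cell l cP)) , proj₂ (lone-walk ans l cP h k)
    where cP = to-cell (valid h) inP

  meets-lone : ∀ {sd} → SameAnswers s t → 2 ≤ ringSize sd → Cell sd P → Hit s t (paired sd) P →
               Σ[ U ∈ Pos ] Cell sd U × Hit s t (paired sd) U × Hit t s (lone sd) U
  meets-lone {s} {t} {P} {sd} ans 2≤n cP h with answered ans h
  ... | d , k with ringCol sd d
  ...   | is-lone = P , cP , h , k
  ...   | is-link along = ⊥-elim (not-both h k)
  ...   | is-link across =
    mate along P , mate-cell along cP , spread h (mate along P) (cell-valid (mate-cell along cP)) (mate-coord along cP) , kU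
    where
    cV = mate-cell across cP
    hV : Hit s t (lone sd) (mate across P)
    hV = subst (λ c → Hit s t c (mate across P)) (third-links sd along)
           (step ans h k (mate across P) (cell-valid cV) (mate-coord across cP) (crossing-leaves-pair 2≤n cP))
    kU : Hit t s (lone sd) (mate along P)
    kU = subst (λ R → Hit t s (lone sd) (mate along R)) (mate-mate across cP)
           (proj₂ (lone-walk ans across cV hV (spread k (mate across P) (cell-valid cV) (mate-coord across cP))))

  paired-cells : ∀ {sd} → SameAnswers s t → Cell sd P → Hit s t (paired sd) P → Cell sd Q → Hit t s (paired sd) Q → ⊥
  paired-cells {s = s} {t = t} {P = P} {sd = sd} ans cP h cQ k with ringSize sd ≟ 1
  ... | yes n≡1 = not-both h (spread k P (valid h) (one-pair n≡1 cP cQ))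
  ... | no n≢1 with meets-lone ans 2≤n cP h | meets-lone (SameAnswers-sym ans) 2≤n cQ k
    where
    2≤n : 2 ≤ ringSize sd
    2≤n = ≤∧≢⇒< (ring-nonempty cP) (λ e → n≢1 (sym e))
  ... | U , cU , hU , kU | U′ , cU′ , kU′ , hU′ = along≢across (linkCol-injective sd (hit-unique ans hU hW))
    where
    walk = lone-walk ans along cU′ hU′ kU′
    cM = mate-cell along cU′
    cW = mate-cell across cM
    U≡W : U ≡ mate across (mate along U′)
    U≡W = lone-class cW (same-class kU (proj₂ walk))
    hW : Hit s t c₃ U
    hW = subst (Hit s t c₃) (sym U≡W) (spread (proj₁ walk) _ (cell-valid cW) (mate-coord across cM))

  paired-unbalanced : ∀ {sd} → SameAnswers s t → Covers s t (ringᴮ sd) (paired sd) → Covers t s (ringᴮ sd) (paired sd) → ⊥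
  paired-unbalanced ans (P , inP , h) (Q , inQ , k) = paired-cells ans (to-cell (valid h) inP) h (to-cell (valid k) inQ) k

  ring-reach : ∀ {sd} → SameAnswers s t → Cell sd P → Hit s t (lone sd) P → ∀ {l′} → Hit t s (linkCol sd l′) P → ∀ l →
               Involved s t (ringᴮ sd) (linkCol sd l)
  ring-reach {P = P} ans cP h {l′} k l with l′ ≟ˡ l
  ... | yes refl = theirs (cell-block cP) k
  ... | no l′≢l = mine (cell-block (mate-cell l′ cP))
                      (subst (λ m → Hit _ _ (linkCol _ m) (mate l′ P)) (turn-≢ l′≢l) (proj₁ (lone-walk ans l′ cP h k)))

  ring-involved : ∀ {sd} → SameAnswers s t → Cell sd P → Hit s t c P → ∀ l → Involved s t (ringᴮ sd) (linkCol sd l)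
  ring-involved {P = P} {c = c} {sd = sd} ans cP h l with answered ans h
  ... | d , k with ringCol sd c | ringCol sd d
  ...   | is-lone | is-lone = ⊥-elim (not-both h k)
  ...   | is-lone | is-link l₂ = ring-reach ans cP h {l₂} k l
  ...   | is-link l₁ | is-lone = Data.Sum.swap (ring-reach (SameAnswers-sym ans) cP k {l₁} h l)
  ...   | is-link l₁ | is-link l₂ with l₁ ≟ˡ l
  ...     | yes refl = mine (cell-block cP) h
  ...     | no l₁≢l = theirs (cell-block cP) (subst (λ m → Hit _ _ (linkCol sd m) P) (link-≢ l₁≢l l₁≢l₂) k)
    where
    l₁≢l₂ : l₁ ≢ l₂
    l₁≢l₂ refl = not-both h k


  -- The path

  -- After i a: a is the other question of the column-2 class of path i true.
  data After (i : ℕ) : Pos → Set where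
    last : i ≡ Z → After i apex
    next : i < Z → After i (path (suc i) false)

  after : ∀ {i} → i ≤ Z → Σ[ a ∈ Pos ] After i a
  after {i} i≤Z with i ≟ Z
  ... | yes i≡Z = apex , last i≡Z
  ... | no i≢Z = path (suc i) false , next (≤∧≢⇒< i≤Z i≢Z)

  after-valid : ∀ {i a} → After i a → Valid a
  after-valid (last _) = tt
  after-valid (next i<Z) = i<Z

  after-block : ∀ {i a} → After i a → blockOf a ≡ pathᴮ
  after-block (last _) = refl
  after-block (next _) = refl

  after-c₂ : ∀ {i a} → After i a → coord c₂ a ≡ coord c₂ (path i true)
  after-c₂ (last refl) = cong (pathᴮ ,_) (sym (if-true (≡ᵇ-true {Z} refl)))
  after-c₂ (next i<Z) = cong (pathᴮ ,_) (sym (if-false (≡ᵇ-false (λ e → <-irrefl (suc-injective (suc-injective e)) i<Z))))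

  after-c₁ : ∀ {i a} → After i a → coord c₁ a ≢ coord c₁ (path i true)
  after-c₁ (last _) ()
  after-c₁ (next _) e = 1+n≢n (suc-injective (cong proj₂ e))

  after-c₃ : ∀ {i a} → After i a → Σ[ j ∈ ℕ ] coord c₃ a ≡ coord c₃ (path j false)
  after-c₃ (last _) = 0 , refl
  after-c₃ {i} (next _) = suc i , refl

  c₃-parity : ∀ {j k} → coord c₃ (path j false) ≢ coord c₃ (path k true)
  c₃-parity e with pairIndex-injective (cong proj₂ e)
  ... | _ , ()

  c₃-index : ∀ {j k b} → coord c₃ (path j b) ≡ coord c₃ (path k b) → j ≡ k
  c₃-index e = proj₁ (pairIndex-injective (cong proj₂ e))

  after-c₃-odd : ∀ {i a k} → After i a → coord c₃ a ≢ coord c₃ (path k true)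
  after-c₃-odd aft e with after-c₃ aft
  ... | j , ej = c₃-parity (trans (sym ej) e)

  c₂-cell : ∀ {i} → coord c₂ (path i true) ≢ coord c₂ (path i false)
  c₂-cell e = cyclicSuc-moves (s≤s (s≤s z≤n)) (cong proj₂ e)

  -- The answers of t on a pair class of s in column 1 (resp. 2); the constructor says whether the answer of t
  -- in column 2 (resp. 1) leads backward or forward along the path.
  data Answers₁ (s t : Triple) (i : ℕ) : Set where
    backward : Hit t s c₂ (path i false) → Hit t s c₃ (path i true) → Answers₁ s t i
    forward : Hit t s c₃ (path i false) → Hit t s c₂ (path i true) → Answers₁ s t i

  data Answers₂ (s t : Triple) (i : ℕ) (a : Pos) : Set where
    backward : Hit t s c₁ (path i true) → Hit t s c₃ a → Answers₂ s t i a
    forward : Hit t s c₃ (path i true) → Hit t s c₁ a → Answers₂ s t i a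

  c₁-answers : ∀ {i} → SameAnswers s t → Hit s t c₁ (path i false) → Answers₁ s t i
  c₁-answers ans h with answered ans h
  ... | c₁ , k = ⊥-elim (not-both h k)
  ... | c₂ , k = backward k (step (SameAnswers-sym ans) k h (path _ true) (valid h) refl c₂-cell)
  ... | c₃ , k = forward k (step (SameAnswers-sym ans) k h (path _ true) (valid h) refl (λ e → c₃-parity (sym e)))

  c₂-answers : ∀ {i a} → SameAnswers s t → Hit s t c₂ (path i true) → After i a → Answers₂ s t i a
  c₂-answers ans h aft with answered ans h
  ... | c₂ , k = ⊥-elim (not-both h k)
  ... | c₁ , k = backward k (step (SameAnswers-sym ans) k h _ (after-valid aft) (after-c₂ aft) (after-c₁ aft))
  ... | c₃ , k = forward k (step (SameAnswers-sym ans) k h _ (after-valid aft) (after-c₂ aft) (after-c₃-odd aft))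

  c₁-pair-apex : ∀ {i} → SameAnswers s t → Hit s t c₁ (path i false) → Hit t s c₁ apex → ⊥
  c₁-pair-apex {s} {t} {i} ans h k with answered (SameAnswers-sym ans) k | c₁-answers ans h
  ... | c₁ , hA | _ = not-both hA k
  ... | c₂ , hA | backward _ k₃ =
    collide ans (spread h (path i true) (valid h) refl)
                (subst (λ j → Hit s t c₂ (path j true)) (sym (c₃-index (same-class k₃ kZ))) hZ) (λ ())
    where
    hZ : Hit s t c₂ (path Z true)
    hZ = spread hA (path Z true) ≤-refl (sym (after-c₂ (last refl)))
    kZ : Hit t s c₃ (path Z true)
    kZ = step (SameAnswers-sym ans) k hA (path Z true) ≤-refl (sym (after-c₂ (last refl))) (λ ())
  ... | c₂ , hA | forward k₃ _ =
    c₃-parity (same-class k₃ (step (SameAnswers-sym ans) k hA (path Z true) ≤-refl (sym (after-c₂ (last refl))) (λ ())))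
  ... | c₃ , hA | backward k₂ _ =
    collide ans (subst (λ j → Hit s t c₁ (path j false)) i≡0 h) (spread hA (path 0 false) z≤n refl) (λ ())
    where
    i≡0 : i ≡ 0
    i≡0 = suc-injective (cong proj₂ (same-class k₂ (step (SameAnswers-sym ans) k hA (path 0 false) z≤n refl (λ ()))))
  ... | c₃ , hA | forward _ k₂ =
    cyclicSuc-suc-≢1 (suc (suc Z)) i (cong proj₂ (same-class k₂ (step (SameAnswers-sym ans) k hA (path 0 false) z≤n refl (λ ()))))

  c₁-backward-backward : ∀ {i k} → SameAnswers s t → Hit s t c₁ (path (suc i) false) → Hit t s c₂ (path (suc i) false) →
                         Hit s t c₃ (path k true) → Hit t s c₁ (path k false) → ⊥
  c₁-backward-backward {s} {t} {i} {k} ans h k₂ h₃ k₁ =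
    collide (SameAnswers-sym ans) (subst (λ j → Hit t s c₂ (path j true)) (c₃-index (same-class hᵢ h₃)) kᵢ)
                                  (spread k₁ (path k true) (valid h₃) refl) (λ ())
    where
    back : coord c₂ (path i true) ≡ coord c₂ (path (suc i) false)
    back = sym (after-c₂ (next (valid h)))
    hᵢ : Hit s t c₃ (path i true)
    hᵢ = step ans h k₂ (path i true) (<⇒≤ (valid h)) back (λ e → 1+n≢n (sym (suc-injective (cong proj₂ e))))
    kᵢ : Hit t s c₂ (path i true)
    kᵢ = spread k₂ (path i true) (<⇒≤ (valid h)) back

  c₁-forward-forward : ∀ {i k a} → SameAnswers s t → Hit s t c₁ (path i true) → Hit t s c₂ (path i true) → After i a →
                       Hit s t c₃ (path k false) → Hit t s c₁ (path k false) → i ≡ Z × k ≡ 0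
  c₁-forward-forward ans h k₂ (last i≡Z) h₃ _ =
    i≡Z , sym (c₃-index (same-class (step ans h k₂ apex tt (after-c₂ (last i≡Z)) (after-c₁ (last i≡Z))) h₃))
  c₁-forward-forward {s} {t} {i} ans h k₂ (next i<Z) h₃ k₁ = ⊥-elim (collide (SameAnswers-sym ans) kₐ k₁′ (λ ()))
    where
    hₐ : Hit s t c₃ (path (suc i) false)
    hₐ = step ans h k₂ (path (suc i) false) i<Z (after-c₂ (next i<Z)) (after-c₁ (next i<Z))
    kₐ : Hit t s c₂ (path (suc i) false)
    kₐ = spread k₂ (path (suc i) false) i<Z (after-c₂ (next i<Z))
    k₁′ : Hit t s c₁ (path (suc i) false)
    k₁′ = subst (λ j → Hit t s c₁ (path j false)) (sym (c₃-index (same-class hₐ h₃))) k₁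

  c₁-backward-forward : ∀ {i k a} → SameAnswers s t → Hit t s c₃ (path i true) → Hit s t c₂ (path k true) →
                        Hit t s c₁ (path k true) → After k a → ⊥
  c₁-backward-forward ans k₃ h₂ k₁ aft =
    after-c₃-odd aft (same-class (step (SameAnswers-sym ans) k₁ h₂ _ (after-valid aft) (after-c₂ aft) (after-c₁ aft)) k₃)

  c₁-pair-pair : ∀ {i k} → i ≢ k → SameAnswers s t → Hit s t c₁ (path i false) → Hit t s c₁ (path k false) → ⊥
  c₁-pair-pair {i = i} {k} i≢k ans h k₁ with c₁-answers ans h | c₁-answers (SameAnswers-sym ans) k₁
  ... | backward k₂ k₃ | backward h₂ h₃ with i | k
  ...   | suc _ | _ = c₁-backward-backward ans h k₂ h₃ k₁
  ...   | zero | suc _ = c₁-backward-backward (SameAnswers-sym ans) k₁ h₂ k₃ h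
  ...   | zero | zero = i≢k refl
  c₁-pair-pair {i = i} {k} i≢k ans h k₁ | forward k₃ k₂ | forward h₃ h₂ =
    i≢k (trans (proj₂ (c₁-forward-forward (SameAnswers-sym ans) k₁′ h₂ (proj₂ (after (valid k₁))) k₃ h))
               (sym (proj₂ (c₁-forward-forward ans h′ k₂ (proj₂ (after (valid h))) h₃ k₁))))
    where
    h′ = spread h (path i true) (valid h) refl
    k₁′ = spread k₁ (path k true) (valid k₁) refl
  c₁-pair-pair {k = k} i≢k ans h k₁ | backward _ k₃ | forward _ h₂ =
    c₁-backward-forward ans k₃ h₂ (spread k₁ (path k true) (valid k₁) refl) (proj₂ (after (valid k₁)))
  c₁-pair-pair {i = i} i≢k ans h k₁ | forward _ k₂ | backward _ h₃ =
    c₁-backward-forward (SameAnswers-sym ans) h₃ k₂ (spread h (path i true) (valid h) refl) (proj₂ (after (valid h)))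

  c₁-class : blockOf P ≡ pathᴮ → Hit s t c₁ P → P ≡ apex ⊎ Σ[ i ∈ ℕ ] Hit s t c₁ (path i false)
  c₁-class {path i b} _ h = inj₂ (i , spread h (path i false) (valid h) refl)
  c₁-class {apex} _ _ = inj₁ refl

  c₁-unbalanced : SameAnswers s t → Covers s t pathᴮ c₁ → Covers t s pathᴮ c₁ → ⊥
  c₁-unbalanced ans (P , inP , h) (Q , inQ , k) with c₁-class inP h | c₁-class inQ k
  ... | inj₁ refl | inj₁ refl = not-both h k
  ... | inj₁ refl | inj₂ (_ , k′) = c₁-pair-apex (SameAnswers-sym ans) k′ h
  ... | inj₂ (_ , h′) | inj₁ refl = c₁-pair-apex ans h′ k
  ... | inj₂ (i , h′) | inj₂ (j , k′) with i ≟ j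
  ...   | yes refl = not-both h′ k′
  ...   | no i≢j = c₁-pair-pair i≢j ans h′ k′

  c₂-backward-cell : ∀ {i} → SameAnswers s t → Hit s t c₂ (path i true) → Hit t s c₁ (path i true) → Hit s t c₃ (path i false)
  c₂-backward-cell {i = i} ans h k₁ = step ans h k₁ (path i false) (valid h) refl (λ e → c₂-cell (sym e))

  c₂-pair-singleton : ∀ {i} → SameAnswers s t → Hit s t c₂ (path i true) → Hit t s c₂ (path 0 false) → ⊥
  c₂-pair-singleton {s} {t} {i} ans h k with after (valid h)
  ... | a , aft with answered (SameAnswers-sym ans) k | c₂-answers ans h aft
  ...   | c₂ , h₀ | _ = not-both h₀ k
  ...   | c₁ , h₀ | backward _ k₃ =
    after-c₃-odd {k = 0} aft (same-class k₃ (step (SameAnswers-sym ans) k h₀ (path 0 true) z≤n refl c₂-cell))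
  ...   | c₁ , h₀ | forward k₃ _ =
    collide ans (subst (λ j → Hit s t c₂ (path j true)) i≡0 h) (spread h₀ (path 0 true) z≤n refl) (λ ())
    where
    i≡0 : i ≡ 0
    i≡0 = c₃-index (same-class k₃ (step (SameAnswers-sym ans) k h₀ (path 0 true) z≤n refl c₂-cell))
  ...   | c₃ , h₀ | backward k₁ _ with same-class k₁ (step (SameAnswers-sym ans) k h₀ apex tt refl (λ ()))
  ...     | ()
  c₂-pair-singleton ans h k | a , last i≡Z | c₃ , h₀ | forward _ _ =
    collide ans (spread h apex tt (after-c₂ (last i≡Z))) (spread h₀ apex tt refl) (λ ())
  c₂-pair-singleton ans h k | a , next i<Z | c₃ , h₀ | forward _ k₁
    with same-class k₁ (step (SameAnswers-sym ans) k h₀ apex tt refl (λ ()))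
  ...     | ()

  c₂-backward-backward : ∀ {i k a} → SameAnswers s t → Hit s t c₂ (path i true) → Hit t s c₁ (path i true) →
                         Hit t s c₂ (path k true) → After k a → Hit s t c₃ a → k ≡ Z × i ≡ 0
  c₂-backward-backward ans h k₁ k₂ (last k≡Z) h₃ = k≡Z , sym (c₃-index (same-class h₃ (c₂-backward-cell ans h k₁)))
  c₂-backward-backward {s} {t} {i} {k} ans h k₁ k₂ (next k<Z) h₃ = ⊥-elim (collide (SameAnswers-sym ans) kₐ k₁′ (λ ()))
    where
    kₐ : Hit t s c₂ (path (suc k) false)
    kₐ = spread k₂ (path (suc k) false) k<Z (after-c₂ (next k<Z))
    k₁′ : Hit t s c₁ (path (suc k) false)
    k₁′ = subst (λ j → Hit t s c₁ (path j false)) (sym (c₃-index (same-class h₃ (c₂-backward-cell ans h k₁))))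
                (spread k₁ (path i false) (valid h) refl)

  c₂-backward-forward : ∀ {i k} → SameAnswers s t → Hit s t c₂ (path i true) → Hit t s c₁ (path i true) →
                        Hit s t c₃ (path k true) → ⊥
  c₂-backward-forward ans h k₁ h₃ = c₃-parity (same-class (c₂-backward-cell ans h k₁) h₃)

  c₂-forward-forward : ∀ {i k} → SameAnswers s t → i < Z → Hit s t c₂ (path i true) → Hit t s c₁ (path (suc i) false) →
                       Hit s t c₃ (path k true) → Hit t s c₂ (path k true) → ⊥
  c₂-forward-forward {s} {t} {i} ans i<Z h k₁ h₃ k₂ =
    collide (SameAnswers-sym ans) (subst (λ j → Hit t s c₁ (path j true)) (c₃-index (same-class h₃′ h₃)) k₁′) k₂ (λ ())
    where
    hₐ : Hit s t c₂ (path (suc i) false)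
    hₐ = spread h (path (suc i) false) i<Z (after-c₂ (next i<Z))
    h₃′ : Hit s t c₃ (path (suc i) true)
    h₃′ = step ans hₐ k₁ (path (suc i) true) i<Z refl c₂-cell
    k₁′ : Hit t s c₁ (path (suc i) true)
    k₁′ = spread k₁ (path (suc i) true) i<Z refl

  c₂-pair-pair : ∀ {i k} → i ≢ k → SameAnswers s t → Hit s t c₂ (path i true) → Hit t s c₂ (path k true) → ⊥
  c₂-pair-pair i≢k ans h k₂ with after (valid h) | after (valid k₂)
  ... | a , aftᵢ | b , aftₖ with c₂-answers ans h aftᵢ | c₂-answers (SameAnswers-sym ans) k₂ aftₖ
  ...   | backward k₁ k₃ | backward h₁ h₃ =
    i≢k (trans (proj₂ (c₂-backward-backward ans h k₁ k₂ aftₖ h₃)) (sym (proj₂ (c₂-backward-backward (SameAnswers-sym ans) k₂ h₁ h aftᵢ k₃))))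
  ...   | backward k₁ _ | forward h₃ _ = c₂-backward-forward ans h k₁ h₃
  ...   | forward k₃ _ | backward h₁ _ = c₂-backward-forward (SameAnswers-sym ans) k₂ h₁ k₃
  ...   | forward k₃ k₁ | forward h₃ h₁ with aftᵢ | aftₖ
  ...     | next i<Z | _ = c₂-forward-forward ans i<Z h k₁ h₃ k₂
  ...     | last _ | next k<Z = c₂-forward-forward (SameAnswers-sym ans) k<Z k₂ h₁ k₃ h
  ...     | last i≡Z | last k≡Z = i≢k (trans i≡Z (sym k≡Z))

  c₂-class : blockOf P ≡ pathᴮ → Hit s t c₂ P → P ≡ path 0 false ⊎ Σ[ i ∈ ℕ ] Hit s t c₂ (path i true)
  c₂-class {path i true} _ h = inj₂ (i , h)
  c₂-class {path zero false} _ _ = inj₁ refl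
  c₂-class {path (suc i) false} _ h = inj₂ (i , spread h (path i true) (<⇒≤ (valid h)) (sym (after-c₂ (next (valid h)))))
  c₂-class {apex} _ h = inj₂ (Z , spread h (path Z true) ≤-refl (sym (after-c₂ (last refl))))

  c₂-unbalanced : SameAnswers s t → Covers s t pathᴮ c₂ → Covers t s pathᴮ c₂ → ⊥
  c₂-unbalanced ans (P , inP , h) (Q , inQ , k) with c₂-class inP h | c₂-class inQ k
  ... | inj₁ refl | inj₁ refl = not-both h k
  ... | inj₁ refl | inj₂ (_ , k′) = c₂-pair-singleton (SameAnswers-sym ans) k′ h
  ... | inj₂ (_ , h′) | inj₁ refl = c₂-pair-singleton ans h′ k
  ... | inj₂ (i , h′) | inj₂ (j , k′) with i ≟ j
  ...   | yes refl = not-both h′ k′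
  ...   | no i≢j = c₂-pair-pair i≢j ans h′ k′

  involving : ∀ {β} → Involved s t β c₁ → Involved s t β c₂ → Involved s t β c₃ → ∀ c → Involved s t β c
  involving i₁ _ _ c₁ = i₁
  involving _ i₂ _ c₂ = i₂
  involving _ _ i₃ c₃ = i₃

  path-involved₁₂ : SameAnswers s t → blockOf P ≡ pathᴮ → Hit s t c P → c ≢ c₃ → ∀ e → Involved s t pathᴮ e
  path-involved₁₂ {c = c₃} _ _ _ c≢c₃ = ⊥-elim (c≢c₃ refl)
  path-involved₁₂ {P = path i b} {c = c₁} ans _ h _ with c₁-answers ans (spread h (path i false) (valid h) refl)
  ... | backward k₂ k₃ = involving (mine refl h) (theirs refl k₂) (theirs refl k₃)
  ... | forward k₃ k₂ = involving (mine refl h) (theirs refl k₂) (theirs refl k₃)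
  path-involved₁₂ {P = apex} {c = c₁} ans _ h _ with answered ans h
  ... | c₁ , k = ⊥-elim (not-both h k)
  ... | c₂ , k = involving (mine refl h) (theirs refl k)
                   (mine refl (step ans h k (path Z true) ≤-refl (sym (after-c₂ (last refl))) (λ ())))
  ... | c₃ , k = involving (mine refl h) (mine refl (step ans h k (path 0 false) z≤n refl (λ ()))) (theirs refl k)
  path-involved₁₂ {c = c₂} ans inP h _ with c₂-class inP h
  ... | inj₂ (i , h′) with after (valid h′)
  ...   | a , aft with c₂-answers ans h′ aft
  ...     | backward k₁ k₃ = involving (theirs refl k₁) (mine refl h′) (theirs (after-block aft) k₃)
  ...     | forward k₃ k₁ = involving (theirs (after-block aft) k₁) (mine refl h′) (theirs refl k₃)
  path-involved₁₂ {c = c₂} ans inP h _ | inj₁ refl with answered ans h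
  ...   | c₂ , k = ⊥-elim (not-both h k)
  ...   | c₁ , k = involving (theirs refl k) (mine refl h) (mine refl (step ans h k (path 0 true) z≤n refl c₂-cell))
  ...   | c₃ , k = involving (mine refl (step ans h k apex tt refl (λ ()))) (mine refl h) (theirs refl k)

  path-involved : SameAnswers s t → blockOf P ≡ pathᴮ → Hit s t c P → ∀ e → Involved s t pathᴮ e
  path-involved {c = c₁} ans inP h = path-involved₁₂ ans inP h (λ ())
  path-involved {c = c₂} ans inP h = path-involved₁₂ ans inP h (λ ())
  path-involved {c = c₃} ans inP h e with answered ans h
  ... | c₃ , k = ⊥-elim (not-both h k)
  ... | c₁ , k = Data.Sum.swap (path-involved₁₂ (SameAnswers-sym ans) inP k (λ ()) e)
  ... | c₂ , k = Data.Sum.swap (path-involved₁₂ (SameAnswers-sym ans) inP k (λ ()) e)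

  -- No question is hit

  Reached : Triple → Col → Set
  Reached s c = Σ[ Q ∈ Pos ] Valid Q × s ⟨ c ⟩ ≡ F c Q

  record Confusable (s t : Triple) : Set where
    field
      same-answers : SameAnswers s t
      reached-s : ∀ c → c ≢ c₃ → Reached s c
      reached-t : ∀ c → c ≢ c₃ → Reached t c
  open Confusable public

  Confusable-sym : Confusable s t → Confusable t s
  Confusable-sym conf = record
    { same-answers = SameAnswers-sym (same-answers conf) ; reached-s = reached-t conf ; reached-t = reached-s conf }

  Touched : Triple → Triple → Block → Set
  Touched s t β = Σ[ c ∈ Col ] Covers s t β c

  touched-sym : ∀ {β} → SameAnswers s t → Touched s t β → Touched t s β
  touched-sym ans (c , P , inP , h) = proj₁ (answered ans h) , P , inP , proj₂ (answered ans h)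

  same-block : ∀ {β γ} → Covers s t β c → Covers s t γ c → β ≡ γ
  same-block (P , refl , h) (Q , refl , k) = cong proj₁ (same-class h k)

  counterpart : ∀ {β} → Confusable s t → Covers s t β c → c ≢ c₃ → Σ[ γ ∈ Block ] Covers t s γ c
  counterpart {c = c} conf (P , inP , h) c≢c₃ with reached-t conf c c≢c₃
  ... | Q , vQ , eq = blockOf Q , Q , refl , hit vQ (λ e → differs h (sym e)) eq

  path→right : Confusable s t → Covers s t pathᴮ c₁ → Touched s t (ringᴮ right)
  path→right conf cov with counterpart conf cov (λ ())
  ... | ringᴮ left , cov′ with same-block cov (lone-balanced (SameAnswers-sym (same-answers conf)) cov′)
  ...   | ()
  path→right conf cov | ringᴮ right , cov′ = touched-sym (SameAnswers-sym (same-answers conf)) (c₁ , cov′)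
  path→right conf cov | pathᴮ , cov′ = ⊥-elim (c₁-unbalanced (same-answers conf) cov cov′)

  path→left : Confusable s t → Covers s t pathᴮ c₂ → Touched s t (ringᴮ left)
  path→left conf cov with counterpart conf cov (λ ())
  ... | ringᴮ right , cov′ with same-block cov (lone-balanced (SameAnswers-sym (same-answers conf)) cov′)
  ...   | ()
  path→left conf cov | ringᴮ left , cov′ = touched-sym (SameAnswers-sym (same-answers conf)) (c₂ , cov′)
  path→left conf cov | pathᴮ , cov′ = ⊥-elim (c₂-unbalanced (same-answers conf) cov cov′)

  ring-involves-c₃ : ∀ {sd} → SameAnswers s t → Touched s t (ringᴮ sd) → Involved s t (ringᴮ sd) c₃
  ring-involves-c₃ ans (_ , P , inP , h) = ring-involved ans (to-cell (valid h) inP) h across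

  at-most-two : ∀ {β₁ β₂ β₃} → β₁ ≢ β₂ → β₁ ≢ β₃ → β₂ ≢ β₃ →
                Involved s t β₁ c → Involved s t β₂ c → Involved s t β₃ c → ⊥
  at-most-two n₁₂ n₁₃ n₂₃ (inj₁ a) (inj₁ b) _ = n₁₂ (same-block a b)
  at-most-two n₁₂ n₁₃ n₂₃ (inj₂ a) (inj₂ b) _ = n₁₂ (same-block a b)
  at-most-two n₁₂ n₁₃ n₂₃ (inj₁ a) (inj₂ _) (inj₁ c) = n₁₃ (same-block a c)
  at-most-two n₁₂ n₁₃ n₂₃ (inj₂ _) (inj₁ b) (inj₁ c) = n₂₃ (same-block b c)
  at-most-two n₁₂ n₁₃ n₂₃ (inj₁ _) (inj₂ b) (inj₂ c) = n₂₃ (same-block b c)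
  at-most-two n₁₂ n₁₃ n₂₃ (inj₂ a) (inj₁ _) (inj₂ c) = n₁₃ (same-block a c)

  path-untouched : Confusable s t → ¬ Touched s t pathᴮ
  path-untouched conf (c , P , inP , h) =
    at-most-two (λ ()) (λ ()) (λ ()) (ring-involves-c₃ ans touched-left) (ring-involves-c₃ ans touched-right) (involved c₃)
    where
    ans = same-answers conf
    involved = path-involved ans inP h
    touched-right : Touched _ _ (ringᴮ right)
    touched-right with involved c₁
    ... | inj₁ cov = path→right conf cov
    ... | inj₂ cov = touched-sym (SameAnswers-sym ans) (path→right (Confusable-sym conf) cov)
    touched-left : Touched _ _ (ringᴮ left)
    touched-left with involved c₂
    ... | inj₁ cov = path→left conf cov
    ... | inj₂ cov = touched-sym (SameAnswers-sym ans) (path→left (Confusable-sym conf) cov)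

  right-leaves : Confusable s t → ¬ Covers s t (ringᴮ right) c₁
  right-leaves conf cov with counterpart conf cov (λ ())
  ... | ringᴮ left , cov′ with same-block cov (lone-balanced (SameAnswers-sym (same-answers conf)) cov′)
  ...   | ()
  right-leaves conf cov | ringᴮ right , cov′ = paired-unbalanced (same-answers conf) cov cov′
  right-leaves conf cov | pathᴮ , cov′ = path-untouched (Confusable-sym conf) (c₁ , cov′)

  left-leaves : Confusable s t → ¬ Covers s t (ringᴮ left) c₂
  left-leaves conf cov with counterpart conf cov (λ ())
  ... | ringᴮ right , cov′ with same-block cov (lone-balanced (SameAnswers-sym (same-answers conf)) cov′)
  ...   | ()
  left-leaves conf cov | ringᴮ left , cov′ = paired-unbalanced (same-answers conf) cov cov′
  left-leaves conf cov | pathᴮ , cov′ = path-untouched (Confusable-sym conf) (c₂ , cov′)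

  ring-untouched : ∀ sd → Confusable s t → ¬ Touched s t (ringᴮ sd)
  ring-untouched sd conf (c , P , inP , h) with ring-involved (same-answers conf) (to-cell (valid h) inP) h along
  ring-untouched left conf _ | inj₁ cov = left-leaves conf cov
  ring-untouched left conf _ | inj₂ cov = left-leaves (Confusable-sym conf) cov
  ring-untouched right conf _ | inj₁ cov = right-leaves conf cov
  ring-untouched right conf _ | inj₂ cov = right-leaves (Confusable-sym conf) cov

  no-hit : Confusable s t → ¬ Hit s t c P
  no-hit {P = P} conf h with blockOf P in inP
  ... | ringᴮ sd = ring-untouched sd conf (_ , P , inP , h)
  ... | pathᴮ = path-untouched conf (_ , P , inP , h)

  agree : Confusable s t → ∀ c → c ≢ c₃ → s ⟨ c ⟩ ≡ t ⟨ c ⟩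
  agree {s} {t} conf c c≢c₃ with reached-s conf c c≢c₃ | s ⟨ c ⟩ ≟ t ⟨ c ⟩
  ... | _ | yes same = same
  ... | Q , vQ , eq | no differ = ⊥-elim (no-hit {c = c} conf (hit vQ differ eq))

map-pairs : ∀ {A B : Set} (h : A → B) f n → map h (pairs f n) ≡ pairs (λ i b → h (f i b)) n
map-pairs h f zero = refl
map-pairs h f (suc n) = cong (λ l → h (f 0 false) ∷ h (f 0 true) ∷ l) (map-pairs h (λ i → f (suc i)) n)

pairs-cong : ∀ {A : Set} {f g : ℕ → Bool → A} n → (∀ i b → f i b ≡ g i b) → pairs f n ≡ pairs g n
pairs-cong zero _ = refl
pairs-cong (suc n) f≗g = cong₂ _∷_ (f≗g 0 false) (cong₂ _∷_ (f≗g 0 true) (pairs-cong n (λ i → f≗g (suc i))))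

applyUpTo-cong : ∀ {A : Set} {f g : ℕ → A} n → (∀ i → f i ≡ g i) → applyUpTo f n ≡ applyUpTo g n
applyUpTo-cong zero _ = refl
applyUpTo-cong (suc n) f≗g = cong₂ _∷_ (f≗g 0) (applyUpTo-cong n (λ i → f≗g (suc i)))

twice-applyUpTo : ∀ f n → twice (applyUpTo f n) ≡ pairs (λ i _ → f i) n
twice-applyUpTo f zero = refl
twice-applyUpTo f (suc n) = cong (λ l → f 0 ∷ f 0 ∷ l) (twice-applyUpTo (λ i → f (suc i)) n)

applyUpTo-double : ∀ {A : Set} (f : ℕ → A) n → applyUpTo f (n + n) ≡ pairs (λ i b → f (pairIndex i b)) n
applyUpTo-double f zero = refl
applyUpTo-double f (suc n) rewrite +-suc n n =
  cong (λ l → f 0 ∷ f 1 ∷ l) (applyUpTo-double (λ i → f (suc (suc i))) n)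

wrapped : ∀ f w n → f 0 ∷ (twice (applyUpTo (λ i → f (suc i)) n) ++ w ∷ []) ≡
          pairs (λ i b → if b then (if suc i ≡ᵇ suc n then w else f (suc i)) else f i) (suc n)
wrapped f w zero = refl
wrapped f w (suc n) = cong (λ l → f 0 ∷ f 1 ∷ l) (wrapped (λ i → f (suc i)) w n)

block-double : ∀ n {l : List ℕ} {f : ℕ → Bool → ℕ} → l ≡ pairs f n → block (n + n) l ≡ pairs f n
block-double zero _ = refl
block-double (suc n) e = e

range-count : ∀ lo hi {n} → suc hi ∸ lo ≡ n → range lo hi ≡ applyUpTo (lo +_) n
range-count lo hi refl = map-upTo (lo +_) (suc hi ∸ lo)

cyclic-block : ∀ n K → block (n + n) ((K + 1) ∷ (twice (range (K + 2) (K + n)) ++ (K + 1) ∷ [])) ≡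
               pairs (λ i b → suc (K + (if b then cyclicSuc n i else i))) n
cyclic-block zero K = refl
cyclic-block (suc m) K = begin
  (K + 1) ∷ (twice (range (K + 2) (K + suc m)) ++ (K + 1) ∷ [])
    ≡⟨ cong (λ l → (K + 1) ∷ (twice l ++ (K + 1) ∷ [])) (trans (range-count (K + 2) (K + suc m) count) (applyUpTo-cong m shift)) ⟩
  (K + 1) ∷ (twice (applyUpTo (λ i → K + 1 + suc i) m) ++ (K + 1) ∷ [])
    ≡⟨ cong (λ x → x ∷ (twice (applyUpTo (λ i → K + 1 + suc i) m) ++ (K + 1) ∷ [])) (sym (+-identityʳ (K + 1))) ⟩
  (K + 1 + 0) ∷ (twice (applyUpTo (λ i → K + 1 + suc i) m) ++ (K + 1) ∷ [])
    ≡⟨ wrapped (λ i → K + 1 + i) (K + 1) m ⟩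
  pairs (λ i b → if b then (if suc i ≡ᵇ suc m then K + 1 else K + 1 + suc i) else K + 1 + i) (suc m)
    ≡⟨ pairs-cong (suc m) entry ⟩
  pairs (λ i b → suc (K + (if b then cyclicSuc (suc m) i else i))) (suc m) ∎
  where
  open ≡-Reasoning
  count : suc (K + suc m) ∸ (K + 2) ≡ m
  count = trans (cong (_∸ (K + 2)) (solve 2 (λ K m → con 1 :+ (K :+ (con 1 :+ m)) := (K :+ con 2) :+ m) refl K m)) (m+n∸m≡n (K + 2) m)
  shift : ∀ i → K + 2 + i ≡ K + 1 + suc i
  shift = solve 2 (λ K i → K :+ con 2 :+ i := K :+ con 1 :+ (con 1 :+ i)) refl K
  entry : ∀ i b → (if b then (if suc i ≡ᵇ suc m then K + 1 else K + 1 + suc i) else K + 1 + i) ≡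
                  suc (K + (if b then cyclicSuc (suc m) i else i))
  entry i false = solve 2 (λ K i → K :+ con 1 :+ i := con 1 :+ (K :+ i)) refl K i
  entry i true with suc i ≡ᵇ suc m
  ... | true = solve 1 (λ K → K :+ con 1 := con 1 :+ (K :+ con 0)) refl K
  ... | false = solve 2 (λ K i → K :+ con 1 :+ (con 1 :+ i) := con 1 :+ (K :+ (con 1 :+ i))) refl K i
-- The lists of Defs with x, y, z abstracted: list₁ a b c is shape₁ (xp a b c) (yp a b c) (zp a b c) a by
-- definition, and similarly for the others, so that x, y, z can be rewritten.
shape₁ shape₂ shape₃ : ℕ → ℕ → ℕ → ℕ → List ℕ
shape₁ x y z a =
  block (x ∸ 1) (range 1 (x ∸ 1))
  ++ block (y ∸ 1) (twice (range x (x ∸ 1 + (y ∸ 1) / 2)))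
  ++ block (z + 2) ((x + (y ∸ 1) / 2) ∷ twice (range (x + (y ∸ 1) / 2 + 1) a))
shape₂ x y z b =
  block (x ∸ 1) (twice (range 1 h))
  ++ block (y ∸ 1) (range (h + 1) (h + (y ∸ 1)))
  ++ block (z + 2) ((h + y) ∷ (h + y + 1) ∷ (twice (range (h + y + 2) b) ++ (h + y) ∷ []))
  where
  h = (x ∸ 1) / 2
shape₃ x y z c′ =
  block (x ∸ 1) (1 ∷ (twice (range 2 h) ++ 1 ∷ []))
  ++ block (y ∸ 1) ((h + 1) ∷ (twice (range (h + 2) (h + k)) ++ (h + 1) ∷ []))
  ++ block (z + 2) ((h + k + 1) ∷ (h + k + 1) ∷ range (h + k + 2) c′)
  where
  h = (x ∸ 1) / 2
  k = (y ∸ 1) / 2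

half-double : ∀ n → (n + n) / 2 ≡ n
half-double n = trans (cong (_/ 2) (solve 1 (λ n → n :+ n := n :* con 2) refl n)) (m*n/n≡m n 2)

module Lists (X Y Z : ℕ) where
  open Questions X Y Z
  open ≡-Reasoning

  map-allPos : ∀ c → map (F c) allPos ≡
               map (F c) (pairs (ring left) X) ++ map (F c) (pairs (ring right) Y) ++ F c apex ∷ map (F c) (pairs path (suc Z))
  map-allPos c = trans (map-++ (F c) (pairs (ring left) X) _) (cong (map (F c) (pairs (ring left) X) ++_) (map-++ (F c) (pairs (ring right) Y) _))

  list₁-left : block (X + X) (range 1 (X + X)) ≡ map (F c₁) (pairs (ring left) X)
  list₁-left = trans (block-double X (trans (range-count 1 (X + X) refl) (applyUpTo-double suc X)))
                     (sym (map-pairs (F c₁) (ring left) X))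

  list₁-right : block (Y + Y) (twice (range (suc (X + X)) (X + X + Y))) ≡ map (F c₁) (pairs (ring right) Y)
  list₁-right = trans (block-double Y (trans (cong twice (range-count (suc (X + X)) (X + X + Y) (m+n∸m≡n (X + X) Y)))
                                             (twice-applyUpTo _ Y)))
                      (sym (map-pairs (F c₁) (ring right) Y))

  list₁-path : twice (range (suc (X + X) + Y + 1) (size c₁)) ≡ map (F c₁) (pairs path (suc Z))
  list₁-path = begin
    twice (range lo (size c₁))      ≡⟨ cong twice (range-count lo (size c₁) count) ⟩
    twice (applyUpTo (lo +_) (suc Z)) ≡⟨ twice-applyUpTo (lo +_) (suc Z) ⟩
    pairs (λ i _ → lo + i) (suc Z)  ≡⟨ pairs-cong (suc Z) (λ i _ → solve 4 (λ X Y Z i → con 1 :+ (X :+ X) :+ Y :+ con 1 :+ i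
                                                                                 := con 1 :+ (X :+ X :+ Y :+ (con 1 :+ i))) refl X Y Z i) ⟩
    pairs (λ i b → F c₁ (path i b)) (suc Z) ≡⟨ map-pairs (F c₁) path (suc Z) ⟨
    map (F c₁) (pairs path (suc Z)) ∎
    where
    lo = suc (X + X) + Y + 1
    count : suc (size c₁) ∸ lo ≡ suc Z
    count = trans (cong (_∸ lo) (solve 3 (λ X Y Z → con 2 :+ (X :+ X :+ Y :+ (con 1 :+ Z))
                                                  := (con 1 :+ (X :+ X) :+ Y :+ con 1) :+ (con 1 :+ Z)) refl X Y Z))
                  (m+n∸m≡n lo (suc Z))

  list₁-values : shape₁ (suc (X + X)) (suc (Y + Y)) (suc (Z + Z)) (size c₁) ≡ map (F c₁) allPos
  list₁-values rewrite half-double Y | map-allPos c₁ =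
    cong₂ _++_ list₁-left (cong₂ _++_ list₁-right (cong₂ _∷_ (cong suc (sym (+-identityʳ _))) list₁-path))

  list₂-left : block (X + X) (twice (range 1 X)) ≡ map (F c₂) (pairs (ring left) X)
  list₂-left = trans (block-double X (trans (cong twice (range-count 1 X refl)) (twice-applyUpTo suc X)))
                     (sym (map-pairs (F c₂) (ring left) X))

  list₂-right : block (Y + Y) (range (X + 1) (X + (Y + Y))) ≡ map (F c₂) (pairs (ring right) Y)
  list₂-right = begin
    block (Y + Y) (range (X + 1) (X + (Y + Y)))
      ≡⟨ block-double Y (trans (range-count (X + 1) (X + (Y + Y)) count) (applyUpTo-double ((X + 1) +_) Y)) ⟩
    pairs (λ i b → X + 1 + pairIndex i b) Y
      ≡⟨ pairs-cong Y (λ i b → solve 2 (λ X p → X :+ con 1 :+ p := con 1 :+ (X :+ p)) refl X (pairIndex i b)) ⟩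
    pairs (λ i b → F c₂ (ring right i b)) Y
      ≡⟨ map-pairs (F c₂) (ring right) Y ⟨
    map (F c₂) (pairs (ring right) Y) ∎
    where
    count : suc (X + (Y + Y)) ∸ (X + 1) ≡ Y + Y
    count = trans (cong (_∸ (X + 1)) (solve 2 (λ X Y → con 1 :+ (X :+ (Y :+ Y)) := (X :+ con 1) :+ (Y :+ Y)) refl X Y))
                  (m+n∸m≡n (X + 1) (Y + Y))

  list₂-path : let w = X + suc (Y + Y) in
               (w + 1) ∷ (twice (range (w + 2) (size c₂)) ++ w ∷ []) ≡ map (F c₂) (pairs path (suc Z))
  list₂-path = begin
    (w + 1) ∷ (twice (range (w + 2) (size c₂)) ++ w ∷ [])
      ≡⟨ cong₂ (λ x l → x ∷ (twice l ++ w ∷ [])) (sym (+-identityʳ (w + 1)))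
               (trans (range-count (w + 2) (size c₂) count) (applyUpTo-cong Z shift)) ⟩
    f 0 ∷ (twice (applyUpTo (λ i → f (suc i)) Z) ++ w ∷ [])
      ≡⟨ wrapped f w Z ⟩
    pairs (λ i b → if b then (if suc i ≡ᵇ suc Z then w else f (suc i)) else f i) (suc Z)
      ≡⟨ pairs-cong (suc Z) entry ⟩
    pairs (λ i b → F c₂ (path i b)) (suc Z)
      ≡⟨ map-pairs (F c₂) path (suc Z) ⟨
    map (F c₂) (pairs path (suc Z)) ∎
    where
    w = X + suc (Y + Y)
    f : ℕ → ℕ
    f i = w + 1 + i
    count : suc (size c₂) ∸ (w + 2) ≡ Z
    count = trans (cong (_∸ (w + 2)) (solve 3 (λ X Y Z → con 2 :+ (X :+ (Y :+ Y) :+ (con 1 :+ Z))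
                                                     := (X :+ (con 1 :+ (Y :+ Y)) :+ con 2) :+ Z) refl X Y Z))
                  (m+n∸m≡n (w + 2) Z)
    shift : ∀ i → w + 2 + i ≡ f (suc i)
    shift = solve 3 (λ X Y i → X :+ (con 1 :+ (Y :+ Y)) :+ con 2 :+ i := X :+ (con 1 :+ (Y :+ Y)) :+ con 1 :+ (con 1 :+ i)) refl X Y
    entry : ∀ i b → (if b then (if suc i ≡ᵇ suc Z then w else f (suc i)) else f i) ≡ F c₂ (path i b)
    entry i false = solve 3 (λ X Y i → X :+ (con 1 :+ (Y :+ Y)) :+ con 1 :+ i := con 1 :+ (X :+ (Y :+ Y) :+ (con 1 :+ i))) refl X Y i
    entry i true with i ≡ᵇ Z
    ... | true = solve 2 (λ X Y → X :+ (con 1 :+ (Y :+ Y)) := con 1 :+ (X :+ (Y :+ Y) :+ con 0)) refl X Y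
    ... | false = solve 3 (λ X Y i → X :+ (con 1 :+ (Y :+ Y)) :+ con 1 :+ (con 1 :+ i) := con 1 :+ (X :+ (Y :+ Y) :+ (con 2 :+ i))) refl X Y i

  list₂-values : shape₂ (suc (X + X)) (suc (Y + Y)) (suc (Z + Z)) (size c₂) ≡ map (F c₂) allPos
  list₂-values rewrite half-double X | map-allPos c₂ =
    cong₂ _++_ list₂-left (cong₂ _++_ list₂-right
      (cong₂ _∷_ (solve 2 (λ X Y → X :+ (con 1 :+ (Y :+ Y)) := con 1 :+ (X :+ (Y :+ Y) :+ con 0)) refl X Y) list₂-path))

  list₃-left : pairs (λ i b → suc (0 + (if b then cyclicSuc X i else i))) X ≡ map (F c₃) (pairs (ring left) X)
  list₃-left = trans (pairs-cong X (λ { i false → refl ; i true → refl })) (sym (map-pairs (F c₃) (ring left) X))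

  list₃-right : pairs (λ i b → suc (X + (if b then cyclicSuc Y i else i))) Y ≡ map (F c₃) (pairs (ring right) Y)
  list₃-right = trans (pairs-cong Y (λ { i false → refl ; i true → refl })) (sym (map-pairs (F c₃) (ring right) Y))

  list₃-path : (X + Y + 1) ∷ range (X + Y + 2) (size c₃) ≡ map (F c₃) (pairs path (suc Z))
  list₃-path = begin
    lo ∷ range (X + Y + 2) (size c₃)
      ≡⟨ cong₂ _∷_ (sym (+-identityʳ lo)) (trans (range-count (X + Y + 2) (size c₃) count) (applyUpTo-cong (pairIndex Z true) shift)) ⟩
    applyUpTo (lo +_) (suc (pairIndex Z true))
      ≡⟨ cong (applyUpTo (lo +_)) (trans (cong suc (pairIndex-true Z)) (sym (+-suc (suc Z) Z))) ⟩
    applyUpTo (lo +_) (suc Z + suc Z)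
      ≡⟨ applyUpTo-double (lo +_) (suc Z) ⟩
    pairs (λ i b → lo + pairIndex i b) (suc Z)
      ≡⟨ pairs-cong (suc Z) (λ i b → solve 3 (λ X Y p → X :+ Y :+ con 1 :+ p := con 1 :+ (X :+ Y :+ p)) refl X Y (pairIndex i b)) ⟩
    pairs (λ i b → F c₃ (path i b)) (suc Z)
      ≡⟨ map-pairs (F c₃) path (suc Z) ⟨
    map (F c₃) (pairs path (suc Z)) ∎
    where
    lo = X + Y + 1
    count : suc (size c₃) ∸ (X + Y + 2) ≡ pairIndex Z true
    count = trans (cong (_∸ (X + Y + 2)) (solve 3 (λ X Y p → con 2 :+ (X :+ Y :+ p) := (X :+ Y :+ con 2) :+ p) refl X Y (pairIndex Z true)))
                  (m+n∸m≡n (X + Y + 2) (pairIndex Z true))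
    shift : ∀ i → X + Y + 2 + i ≡ lo + suc i
    shift = solve 3 (λ X Y i → X :+ Y :+ con 2 :+ i := X :+ Y :+ con 1 :+ (con 1 :+ i)) refl X Y

  list₃-values : shape₃ (suc (X + X)) (suc (Y + Y)) (suc (Z + Z)) (size c₃) ≡ map (F c₃) allPos
  list₃-values rewrite half-double X | half-double Y | map-allPos c₃ =
    cong₂ _++_ (trans (cyclic-block X 0) list₃-left) (cong₂ _++_ (trans (cyclic-block Y X) list₃-right)
      (cong₂ _∷_ (solve 2 (λ X Y → X :+ Y :+ con 1 := con 1 :+ (X :+ Y :+ con 0)) refl X Y) list₃-path))

record Shape (a b c : ℕ) : Set where
  constructor shape
  field
    X Y Z e : ℕ
    e≤1 : e ≤ 1
    a≡ : a ≡ Questions.size X Y Z c₁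
    b≡ : b ≡ Questions.size X Y Z c₂
    c≡ : c ≡ Questions.size X Y Z c₃ + e

all-one : ∀ {a b c} → 1 ≤ a → 1 ≤ b → 1 ≤ c → a + b + c ≤ 3 → (a , b , c) ≡ (1 , 1 , 1)
all-one {suc a} {suc b} {suc c} _ _ _ le = cong₂ _,_ (cong suc a≡0) (cong₂ _,_ (cong suc b≡0) (cong suc c≡0))
  where
  rest≡0 : a + b + c ≡ 0
  rest≡0 = n≤0⇒n≡0 (+-cancelˡ-≤ 3 _ 0 (subst (_≤ 3)
             (solve 3 (λ a b c → (con 1 :+ a) :+ (con 1 :+ b) :+ (con 1 :+ c) := con 3 :+ (a :+ b :+ c)) refl a b c) le))
  a≡0 = m+n≡0⇒m≡0 a (m+n≡0⇒m≡0 (a + b) rest≡0)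
  b≡0 = m+n≡0⇒n≡0 a (m+n≡0⇒m≡0 (a + b) rest≡0)
  c≡0 = m+n≡0⇒n≡0 (a + b) rest≡0

module _ {a b c e t : ℕ} (sum : a + b + c ≡ 2 + e + t * 4) where
  open ≤-Reasoning

  quarter<first : b + c ≤ 3 * a → t < a
  quarter<first bc≤3a with t <? a
  ... | yes t<a = t<a
  ... | no t≮a = ⊥-elim (<-irrefl refl (begin-strict
    t * 4                <⟨ m<n+m (t * 4) (s≤s z≤n) ⟩
    2 + e + t * 4        ≡⟨ sum ⟨
    a + b + c            ≡⟨ +-assoc a b c ⟩
    a + (b + c)          ≤⟨ +-monoʳ-≤ a bc≤3a ⟩
    a + 3 * a            ≡⟨ solve 1 (λ a → a :+ con 3 :* a := a :* con 4) refl a ⟩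
    a * 4                ≤⟨ *-monoˡ-≤ 4 (≮⇒≥ t≮a) ⟩
    t * 4                ∎))

  quarter-positive : e ≤ 1 → 1 ≤ a → a ≤ b → b ≤ c → (a , b , c) ≢ (1 , 1 , 1) → 1 ≤ t
  quarter-positive e≤1 1≤a a≤b b≤c not-one with t ≟ 0
  ... | no t≢0 = n≢0⇒n>0 t≢0
  ... | yes refl = ⊥-elim (not-one (all-one 1≤a (≤-trans 1≤a a≤b) (≤-trans 1≤a (≤-trans a≤b b≤c))
                                              (subst (_≤ 3) (sym sum) (s≤s (s≤s (≤-trans (≤-reflexive (+-identityʳ e)) e≤1))))))

quarter<last : ∀ {a b c t} → 1 ≤ t → a ≤ b → b ≤ suc c → a + b + c ≡ 2 + t * 4 → t < c
quarter<last {a} {b} {c} {t} 1≤t a≤b b≤1+c sum with t <? c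
... | yes t<c = t<c
... | no t≮c = ⊥-elim (<-irrefl refl (begin-strict
    2 + t * 3 + 1            ≤⟨ +-monoʳ-≤ (2 + t * 3) 1≤t ⟩
    2 + t * 3 + t            ≡⟨ solve 1 (λ t → con 2 :+ t :* con 3 :+ t := con 2 :+ t :* con 4) refl t ⟩
    2 + t * 4                ≡⟨ sum ⟨
    a + b + c                ≤⟨ +-mono-≤ (+-mono-≤ (≤-trans a≤b b≤1+t) b≤1+t) (≮⇒≥ t≮c) ⟩
    suc t + suc t + t        ≡⟨ solve 1 (λ t → (con 1 :+ t) :+ (con 1 :+ t) :+ t := con 2 :+ t :* con 3) refl t ⟩
    2 + t * 3                <⟨ n<1+n _ ⟩
    suc (2 + t * 3)          ≡⟨ +-comm 1 (2 + t * 3) ⟩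
    2 + t * 3 + 1            ∎))
  where
  open ≤-Reasoning
  b≤1+t : b ≤ suc t
  b≤1+t = ≤-trans b≤1+c (s≤s (≮⇒≥ t≮c))

-- With a = t + 1 + X, b = t + 1 + Y and c - e = t + 1 + Z, the sum a + b + c - e = 4t + 2 forces t = X + Y + Z + 1.
shape-from : ∀ {a b c} e t → e ≤ 1 → a ≤ b → b ≤ c → b + c ≤ 3 * a → (a , b , c) ≢ (1 , 1 , 1) →
             a + b + c ≡ 2 + e + t * 4 → Shape a b c
shape-from {a} {b} {c} e t e≤1 a≤b b≤c bc≤3a not-one sum = shape X Y Z e e≤1 a≡ b≡ c≡
  where
  open ≡-Reasoning
  t<a = quarter<first sum bc≤3a
  1≤t = quarter-positive sum e≤1 (≤-<-trans z≤n t<a) a≤b b≤c not-one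
  cₒ = c ∸ e
  c≡cₒ+e : c ≡ cₒ + e
  c≡cₒ+e = sym (m∸n+n≡m (≤-trans e≤1 (≤-trans (≤-<-trans z≤n t<a) (≤-trans a≤b b≤c))))
  sumₒ : a + b + cₒ ≡ 2 + t * 4
  sumₒ = +-cancelʳ-≡ e _ _ (begin
    a + b + cₒ + e       ≡⟨ +-assoc (a + b) cₒ e ⟩
    a + b + (cₒ + e)     ≡⟨ cong (a + b +_) c≡cₒ+e ⟨
    a + b + c            ≡⟨ sum ⟩
    2 + e + t * 4        ≡⟨ solve 2 (λ e t → con 2 :+ e :+ t :* con 4 := con 2 :+ t :* con 4 :+ e) refl e t ⟩
    2 + t * 4 + e        ∎)
  t<cₒ : t < cₒ
  t<cₒ = quarter<last 1≤t a≤b (≤-trans b≤c (≤-trans (≤-reflexive c≡cₒ+e) (≤-trans (+-monoʳ-≤ cₒ e≤1) (≤-reflexive (+-comm cₒ 1))))) sumₒ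
  X = a ∸ suc t
  Y = b ∸ suc t
  Z = cₒ ∸ suc t
  a≡X : a ≡ suc t + X
  a≡X = sym (m+[n∸m]≡n t<a)
  b≡Y : b ≡ suc t + Y
  b≡Y = sym (m+[n∸m]≡n (≤-trans t<a a≤b))
  cₒ≡Z : cₒ ≡ suc t + Z
  cₒ≡Z = sym (m+[n∸m]≡n t<cₒ)
  t≡ : t ≡ suc (X + Y + Z)
  t≡ = sym (+-cancelˡ-≡ (2 + t * 3) _ _ (begin
    2 + t * 3 + suc (X + Y + Z)              ≡⟨ solve 4 (λ t X Y Z → con 2 :+ t :* con 3 :+ (con 1 :+ (X :+ Y :+ Z))
                                                               := (con 1 :+ t :+ X) :+ (con 1 :+ t :+ Y) :+ (con 1 :+ t :+ Z)) refl t X Y Z ⟩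
    (suc t + X) + (suc t + Y) + (suc t + Z)  ≡⟨ cong₂ _+_ (cong₂ _+_ a≡X b≡Y) cₒ≡Z ⟨
    a + b + cₒ                               ≡⟨ sumₒ ⟩
    2 + t * 4                                ≡⟨ solve 1 (λ t → con 2 :+ t :* con 4 := con 2 :+ t :* con 3 :+ t) refl t ⟩
    2 + t * 3 + t                            ∎))
  a≡ : a ≡ Questions.size X Y Z c₁
  a≡ = trans a≡X (trans (cong (λ u → suc u + X) t≡)
         (solve 3 (λ X Y Z → con 2 :+ (X :+ Y :+ Z) :+ X := con 1 :+ (X :+ X :+ Y :+ (con 1 :+ Z))) refl X Y Z))
  b≡ : b ≡ Questions.size X Y Z c₂
  b≡ = trans b≡Y (trans (cong (λ u → suc u + Y) t≡)
         (solve 3 (λ X Y Z → con 2 :+ (X :+ Y :+ Z) :+ Y := con 1 :+ (X :+ (Y :+ Y) :+ (con 1 :+ Z))) refl X Y Z))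
  c≡ : c ≡ Questions.size X Y Z c₃ + e
  c≡ = trans c≡cₒ+e (cong (_+ e) (trans cₒ≡Z (trans (cong (λ u → suc u + Z) t≡)
         (trans (solve 3 (λ X Y Z → con 2 :+ (X :+ Y :+ Z) :+ Z := con 1 :+ (X :+ Y :+ (con 1 :+ (Z :+ Z)))) refl X Y Z)
                (cong (λ p → suc (X + Y + p)) (sym (pairIndex-true Z)))))))

shape-of : ∀ {a b c} → a ≤ b → b ≤ c → b + c ≤ 3 * a → (a + b + c) % 4 ≡ 2 ⊎ (a + b + c) % 4 ≡ 3 →
           (a , b , c) ≢ (1 , 1 , 1) → Shape a b c
shape-of {a} {b} {c} a≤b b≤c bc≤3a (inj₁ r) not-one =
  shape-from 0 ((a + b + c) / 4) z≤n a≤b b≤c bc≤3a not-one (trans (m≡m%n+[m/n]*n (a + b + c) 4) (cong (_+ (a + b + c) / 4 * 4) r))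
shape-of {a} {b} {c} a≤b b≤c bc≤3a (inj₂ r) not-one =
  shape-from 1 ((a + b + c) / 4) (s≤s z≤n) a≤b b≤c bc≤3a not-one (trans (m≡m%n+[m/n]*n (a + b + c) 4) (cong (_+ (a + b + c) / 4 * 4) r))

parity-correction : ∀ n c {e} → e ≤ 1 → n % 2 ≡ e → (if n % 2 ≡ᵇ 0 then c + e else c + e ∸ 1) ≡ c
parity-correction n c {zero} _ p rewrite p = +-identityʳ c
parity-correction n c {suc zero} _ p rewrite p = m+n∸n≡m c 1
parity-correction n c {suc (suc _)} (s≤s ()) _

module Parameters (X Y Z e : ℕ) (e≤1 : e ≤ 1) where
  open Questions X Y Z
  open ≡-Reasoning

  A B C : ℕ
  A = size c₁
  B = size c₂
  C = size c₃ + e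

  half-sum : ℕ
  half-sum = suc (X + X) + suc (Y + Y) + suc (Z + Z)

  size₃ : size c₃ ≡ suc (X + Y + suc (Z + Z))
  size₃ = cong (λ p → suc (X + Y + p)) (pairIndex-true Z)

  sizes-sum : size c₁ + size c₂ + size c₃ ≡ half-sum * 2
  sizes-sum rewrite size₃ = solve 3 (λ X Y Z → con 1 :+ (X :+ X :+ Y :+ (con 1 :+ Z)) :+ (con 1 :+ (X :+ (Y :+ Y) :+ (con 1 :+ Z)))
                                                :+ (con 1 :+ (X :+ Y :+ (con 1 :+ (Z :+ Z))))
                                             := (con 1 :+ (X :+ X) :+ (con 1 :+ (Y :+ Y)) :+ (con 1 :+ (Z :+ Z))) :* con 2) refl X Y Z

  parity : (A + B + C) % 2 ≡ e
  parity = begin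
    (A + B + (size c₃ + e)) % 2   ≡⟨ cong (_% 2) (trans (sym (+-assoc (A + B) (size c₃) e))
                                                      (trans (cong (_+ e) sizes-sum) (+-comm (half-sum * 2) e))) ⟩
    (e + half-sum * 2) % 2       ≡⟨ [m+kn]%n≡m%n e half-sum 2 ⟩
    e % 2                        ≡⟨ m<n⇒m%n≡m (s≤s e≤1) ⟩
    e                            ∎

  c′≡ : c′ A B C ≡ size c₃
  c′≡ = parity-correction (A + B + C) (size c₃) e≤1 parity

  S≡ : S A B C ≡ half-sum
  S≡ = trans (cong (λ x → (A + B + x) / 2) c′≡) (trans (cong (_/ 2) sizes-sum) (m*n/n≡m half-sum 2))

  doubled : ∀ m k → 2 * m ≡ k + half-sum → 2 * m ∸ S A B C ≡ k
  doubled m k e rewrite S≡ = trans (cong (_∸ half-sum) e) (m+n∸n≡m k half-sum)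

  xp≡ : xp A B C ≡ suc (X + X)
  xp≡ = doubled A (suc (X + X)) (solve 3 (λ X Y Z → con 2 :* (con 1 :+ (X :+ X :+ Y :+ (con 1 :+ Z)))
                                       := (con 1 :+ (X :+ X)) :+ ((con 1 :+ (X :+ X)) :+ (con 1 :+ (Y :+ Y)) :+ (con 1 :+ (Z :+ Z)))) refl X Y Z)

  yp≡ : yp A B C ≡ suc (Y + Y)
  yp≡ = doubled B (suc (Y + Y)) (solve 3 (λ X Y Z → con 2 :* (con 1 :+ (X :+ (Y :+ Y) :+ (con 1 :+ Z)))
                                       := (con 1 :+ (Y :+ Y)) :+ ((con 1 :+ (X :+ X)) :+ (con 1 :+ (Y :+ Y)) :+ (con 1 :+ (Z :+ Z)))) refl X Y Z)

  zp≡ : zp A B C ≡ suc (Z + Z)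
  zp≡ = trans (cong (λ c → 2 * c ∸ S A B C) c′≡)
              (doubled (size c₃) (suc (Z + Z)) (trans (cong (2 *_) size₃)
                (solve 3 (λ X Y Z → con 2 :* (con 1 :+ (X :+ Y :+ (con 1 :+ (Z :+ Z))))
                                 := (con 1 :+ (Z :+ Z)) :+ ((con 1 :+ (X :+ X)) :+ (con 1 :+ (Y :+ Y)) :+ (con 1 :+ (Z :+ Z)))) refl X Y Z)))

  shaped : (sh : ℕ → ℕ → ℕ → ℕ → List ℕ) → ∀ d → sh (xp A B C) (yp A B C) (zp A B C) d ≡ sh (suc (X + X)) (suc (Y + Y)) (suc (Z + Z)) d
  shaped sh d rewrite xp≡ | yp≡ | zp≡ = refl

  tabulate-lists : ∀ {l₁ l₂ l₃ n} → l₁ ≡ map (F c₁) allPos → l₂ ≡ map (F c₂) allPos → l₃ ≡ map (F c₃) allPos →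
                   n ≡ length allPos → map (λ k → at l₁ k , at l₂ k , at l₃ k) (upTo n) ≡ map question allPos
  tabulate-lists refl refl refl refl = trans (map-upTo _ (length allPos)) (tabulated allPos)

  questions-listed : Qstrat A B C ≡ map question allPos
  questions-listed = tabulate-lists
    (trans (shaped shape₁ A) (Lists.list₁-values X Y Z))
    (trans (shaped shape₂ B) (Lists.list₂-values X Y Z))
    (trans (cong (shape₃ (xp A B C) (yp A B C) (zp A B C)) c′≡) (trans (shaped shape₃ (size c₃)) (Lists.list₃-values X Y Z)))
    (trans (cong₂ _+_ (cong₂ _+_ xp≡ yp≡) zp≡) (sym length-allPos))

module Strategy (X Y Z e : ℕ) (e≤1 : e ≤ 1) where
  open Questions X Y Z
  open Parameters X Y Z e e≤1

  in-box : ∀ {P} → Valid P → InBox A B C (question P)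
  in-box v = (s≤s z≤n , F-bounded c₁ v) , (s≤s z≤n , F-bounded c₂ v) , (s≤s z≤n , ≤-trans (F-bounded c₃ v) (m≤m+n (size c₃) e))

  confusable : ∀ {s t} → InBox A B C s → InBox A B C t → SameAnswers s t → Confusable s t
  confusable inS inT ans = record { same-answers = ans ; reached-s = reach inS ; reached-t = reach inT }
    where
    reach : ∀ {u} → InBox A B C u → ∀ c → c ≢ c₃ → Reached u c
    reach ((l , h) , _) c₁ _ = F-onto c₁ _ l h
    reach (_ , (l , h) , _) c₂ _ = F-onto c₂ _ l h
    reach _ c₃ c≢c₃ = ⊥-elim (c≢c₃ refl)

  -- Every value of column 3 except possibly c′ + 1 is asked, so two different guesses cannot both escape a hit.
  third-agrees : ∀ {s t} → Confusable s t → In[ C ] (s ⟨ c₃ ⟩) → In[ C ] (t ⟨ c₃ ⟩) → s ⟨ c₃ ⟩ ≡ t ⟨ c₃ ⟩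
  third-agrees {s} {t} conf (1≤s , s≤C) (1≤t , t≤C) with s ⟨ c₃ ⟩ ≟ t ⟨ c₃ ⟩
  ... | yes same = same
  ... | no differ with s ⟨ c₃ ⟩ ≤? size c₃ | t ⟨ c₃ ⟩ ≤? size c₃
  ...   | yes s≤ | _ with F-onto c₃ _ 1≤s s≤
  ...     | Q , vQ , eq = ⊥-elim (no-hit {c = c₃} conf (hit vQ differ eq))
  third-agrees {s} {t} conf (1≤s , s≤C) (1≤t , t≤C) | no differ | no _ | yes t≤ with F-onto c₃ _ 1≤t t≤
  ...     | Q , vQ , eq = ⊥-elim (no-hit {c = c₃} (Confusable-sym conf) (hit vQ (λ e → differ (sym e)) eq))
  third-agrees {s} {t} conf (1≤s , s≤C) (1≤t , t≤C) | no differ | no s≰ | no t≰ =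
    ⊥-elim (differ (trans (just-above s≤C s≰) (sym (just-above t≤C t≰))))
    where
    just-above : ∀ {u} → u ≤ C → ¬ u ≤ size c₃ → u ≡ suc (size c₃)
    just-above u≤C u≰ = ≤-antisym (≤-trans u≤C (≤-trans (+-monoʳ-≤ (size c₃) e≤1) (≤-reflexive (+-comm (size c₃) 1)))) (≰⇒> u≰)

  distinguishing : Distinguishes A B C (map question allPos)
  distinguishing s t inS inT s≢t with any? (λ q → ¬? (g s q ≟ g t q)) (map question allPos)
  ... | yes found = found
  ... | no none = ⊥-elim (s≢t (cong₂ _,_ (agree conf c₁ (λ ()))
                                (cong₂ _,_ (agree conf c₂ (λ ())) (third-agrees conf (proj₂ (proj₂ inS)) (proj₂ (proj₂ inT))))))
    where
    conf = confusable inS inT (record { same-answer = λ P v → decidable-stable (g s (question P) ≟ g t (question P))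
                                          (λ differ → none (Any.map (λ { refl → differ }) (∈-map⁺ question (valid-∈ v)))) })

  feasible : FeasibleStrategy A B C (Qstrat A B C)
  feasible rewrite questions-listed = All.map⁺ (All.map in-box allPos-valid) , distinguishing

lemma7 : (a b c : ℕ) → a ≤ b → b ≤ c → b + c ≤ 3 * a →
         ((a + b + c) % 4 ≡ 2 ⊎ (a + b + c) % 4 ≡ 3) →
         ¬ ((a , b , c) ≡ (1 , 1 , 1)) →
         FeasibleStrategy a b c (Qstrat a b c)
lemma7 a b c a≤b b≤c bc≤3a mod4 not-one with shape-of a≤b b≤c bc≤3a mod4 not-one
... | shape X Y Z e e≤1 refl refl refl = Strategy.feasible X Y Z e e≤1
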